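{- Let $n\ge 2$ and let $A'_0 = I, A'_1,\dots,A'_4$ be the adjacency matrices of the relations $R_0,\dots,R_4$ on $E(K_{n,n,n})$, and let $M = WW^\top$ where $W$ is the inclusion matrix of $E(K_{n,n,n})$ versus triangles of $K_{n,n,n}$ (so $M = nI + A'_3$). Then the orthogonal projections onto the eigenspaces of $M$ for the eigenvalues $3n$, $2n$, $n$ are, respectively, $E_0 = \frac{1}{3n^2}(A'_0 + A'_1 + A'_2 + A'_3 + A'_4)$, $E_1 = \frac{n-1}{n^2}A'_0 + \frac{n-2}{2n^2}A'_1 - \frac{1}{n^2}A'_2 + \frac{n-1}{2n^2}A'_3 - \frac{1}{2n^2}A'_4$, $E_2 = \frac{(n-1)^2}{n^2}A'_0 - \frac{n-1}{n^2}A'_1 + \frac{1}{n^2}A'_2$, and the orthogonal projection onto $\ker(M)$ is $K = I - E_0 - E_1 - E_2$.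
   Context: $K_{n,n,n}$ is the complete $3$-partite graph with three parts of size $n$. Relations on edges: $(e,f)\in R_0$ if $e=f$; $R_1$: $e\neq f$ join the same pair of parts and share a vertex; $R_2$: $e,f$ join the same pair of parts and are disjoint; $R_3$: $e,f$ join different pairs of parts and share a vertex; $R_4$: $e,f$ join different pairs of parts and are disjoint. The adjacency matrix $A'_i$ has $(e,f)$-entry $1$ if $(e,f)\in R_i$ and $0$ otherwise. The inclusion matrix has $(e,t)$-entry $1$ if edge $e$ lies in triangle $t$, else $0$. -}

module Defs where

open import Data.Nat as ℕ using (ℕ; zero; suc)
open import Data.Integer as ℤ using (ℤ; +_)
open import Data.Rational using (ℚ; 0ℚ; 1ℚ; _/_; _+_; _*_; _-_)
open import Data.Fin using (Fin; zero; suc)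
open import Data.Fin.Properties using () renaming (_≟_ to _≟F_)
open import Data.Product using (Σ; ∃; _×_; _,_; proj₁; proj₂)
open import Data.Product.Properties using (≡-dec)
open import Data.Sum using (_⊎_)
open import Data.Bool using (Bool; true; false; _∧_; _∨_; not)
open import Relation.Nullary using (¬_; does)
open import Relation.Binary.PropositionalEquality using (_≡_)

sumFin : ∀ {m} → (Fin m → ℚ) → ℚ
sumFin {zero}  f = 0ℚ
sumFin {suc m} f = f zero + sumFin (λ i → f (suc i))

Vertex : ℕ → Set
Vertex n = Fin 3 × Fin n

_≟V_ : ∀ {n} (u v : Vertex n) → Bool
u ≟V v = does (≡-dec _≟F_ _≟F_ u v)

-- Edges: (k , a , b) where k ∈ Fin 3 names the pair of parts the edge
-- joins (the two parts different from k), a is the index of the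
-- endpoint in the lower of those two parts, b that in the higher one.
-- This enumerates each edge of K_{n,n,n} exactly once.

Edge : ℕ → Set
Edge n = Fin 3 × Fin n × Fin n

lowPart highPart : Fin 3 → Fin 3
lowPart zero = suc zero
lowPart (suc _) = zero
highPart zero = suc (suc zero)
highPart (suc zero) = suc (suc zero)
highPart (suc (suc zero)) = suc zero

end₁ end₂ : ∀ {n} → Edge n → Vertex n
end₁ (k , a , b) = lowPart k , a
end₂ (k , a , b) = highPart k , b

sumE : ∀ {n} → (Edge n → ℚ) → ℚ
sumE f = sumFin (λ k → sumFin (λ a → sumFin (λ b → f (k , a , b))))

edgeEq : ∀ {n} → Edge n → Edge n → Bool
edgeEq (k , a , b) (k' , a' , b') =
  does (k ≟F k') ∧ does (a ≟F a') ∧ does (b ≟F b')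

samePair : ∀ {n} → Edge n → Edge n → Bool
samePair (k , _) (k' , _) = does (k ≟F k')

shareVertex : ∀ {n} → Edge n → Edge n → Bool
shareVertex e f =
  (end₁ e ≟V end₁ f) ∨ (end₁ e ≟V end₂ f) ∨ (end₂ e ≟V end₁ f) ∨ (end₂ e ≟V end₂ f)

R₀ R₁ R₂ R₃ R₄ : ∀ {n} → Edge n → Edge n → Bool
R₀ e f = edgeEq e f
R₁ e f = samePair e f ∧ not (edgeEq e f) ∧ shareVertex e f
R₂ e f = samePair e f ∧ not (shareVertex e f)
R₃ e f = not (samePair e f) ∧ shareVertex e f
R₄ e f = not (samePair e f) ∧ not (shareVertex e f)

Mat : ℕ → Set
Mat n = Edge n → Edge n → ℚ

Vect : ℕ → Set
Vect n = Edge n → ℚ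

ind : Bool → ℚ
ind true = 1ℚ
ind false = 0ℚ

A′₀ A′₁ A′₂ A′₃ A′₄ : ∀ {n} → Mat n
A′₀ e f = ind (R₀ e f)
A′₁ e f = ind (R₁ e f)
A′₂ e f = ind (R₂ e f)
A′₃ e f = ind (R₃ e f)
A′₄ e f = ind (R₄ e f)

I : ∀ {n} → Mat n
I = A′₀

-- Triangles of K_{n,n,n}: one vertex in each part, (x , y , z).
Triangle : ℕ → Set
Triangle n = Fin n × Fin n × Fin n

sumT : ∀ {n} → (Triangle n → ℚ) → ℚ
sumT f = sumFin (λ x → sumFin (λ y → sumFin (λ z → f (x , y , z))))

vertexOf : ∀ {n} → Triangle n → Fin 3 → Fin n
vertexOf (x , y , z) zero = x
vertexOf (x , y , z) (suc zero) = y
vertexOf (x , y , z) (suc (suc zero)) = z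

inTriangle : ∀ {n} → Vertex n → Triangle n → Bool
inTriangle (i , a) t = does (a ≟F vertexOf t i)

W : ∀ {n} → Edge n → Triangle n → ℚ
W e t = ind (inTriangle (end₁ e) t ∧ inTriangle (end₂ e) t)

M : ∀ {n} → Mat n
M e f = sumT (λ t → W e t * W f t)

_·_ : ∀ {n} → Mat n → Mat n → Mat n
(P · Q) e f = sumE (λ g → P e g * Q g f)

_·v_ : ∀ {n} → Mat n → Vect n → Vect n
(P ·v x) e = sumE (λ f → P e f * x f)

_⊕_ _⊖_ : ∀ {n} → Mat n → Mat n → Mat n
(P ⊕ Q) e f = P e f + Q e f
(P ⊖ Q) e f = P e f - Q e f

_⊛_ : ∀ {n} → ℚ → Mat n → Mat n
(c ⊛ P) e f = c * P e f

Eigenspace : ∀ {n} → Mat n → ℚ → Vect n → Set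
Eigenspace P λ′ v = ∀ e → (P ·v v) e ≡ λ′ * v e

Kernel : ∀ {n} → Mat n → Vect n → Set
Kernel P v = ∀ e → (P ·v v) e ≡ 0ℚ

IsOrthProjOnto : ∀ {n} → Mat n → (Vect n → Set) → Set
IsOrthProjOnto P V =
  (∀ e f → (P · P) e f ≡ P e f) ×
  (∀ e f → P e f ≡ P f e) ×
  (∀ x → V (P ·v x)) ×
  (∀ v → V v → ∃ λ x → ∀ e → (P ·v x) e ≡ v e)

-- the rational p / d (only used with d > 0)
frac : ℤ → ℕ → ℚ
frac p zero = 0ℚ
frac p (suc d) = p / suc d

ℕ→ℚ : ℕ → ℚ
ℕ→ℚ n = + n / 1

module _ (n : ℕ) where
  private
    nn = ℕ._*_ n n
    ν = ℕ→ℚ n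

  E₀ : Mat n
  E₀ = frac (+ 1) (ℕ._*_ 3 nn) ⊛ ((((A′₀ ⊕ A′₁) ⊕ A′₂) ⊕ A′₃) ⊕ A′₄)

  E₁ : Mat n
  E₁ = ((((((ν - 1ℚ) * frac (+ 1) nn) ⊛ A′₀)
        ⊕ (((ν - ℕ→ℚ 2) * frac (+ 1) (ℕ._*_ 2 nn)) ⊛ A′₁))
        ⊖ (frac (+ 1) nn ⊛ A′₂))
        ⊕ (((ν - 1ℚ) * frac (+ 1) (ℕ._*_ 2 nn)) ⊛ A′₃))
        ⊖ (frac (+ 1) (ℕ._*_ 2 nn) ⊛ A′₄)

  E₂ : Mat n
  E₂ = ((((ν - 1ℚ) * (ν - 1ℚ) * frac (+ 1) nn) ⊛ A′₀)
        ⊖ (((ν - 1ℚ) * frac (+ 1) nn) ⊛ A′₁))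
        ⊕ (frac (+ 1) nn ⊛ A′₂)

  K : Mat n
  K = ((I ⊖ E₀) ⊖ E₁) ⊖ E₂

-- Write J, F₁ = 2n² E₁ and F₂ = n² E₂ (so that 3n² E₀ = J). Every triangle
-- through an edge is determined by its third vertex, so M = n I + A′₃, and it
-- suffices that A′₃ maps J, F₁, F₂ to 2n J, n F₁ and 0. The A′₃-neighbours of
-- an edge form two fans joining its endpoints to the opposite part, and
-- summing F₁ or F₂ over a fan reduces to counting incidences. Expanding F₁, F₂
-- in the classes R₀,…,R₄ gives M = 3n E₀ + 2n E₁ + n E₂. Symmetric matrices
-- that M scales by distinct nonzero factors and that resolve M in this way
-- are its eigenprojections, and I - E₀ - E₁ - E₂ projects onto the kernel.

module Submission where

open import Defs
open import Data.Nat as ℕ using (ℕ; zero; suc; _≤_)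
import Data.Nat.Properties as ℕ
open import Data.Integer as ℤ using (+_)
import Data.Integer.Properties as ℤ
open import Data.Rational using (ℚ; 0ℚ; 1ℚ; _+_; _*_; _-_; -_; 1/_; ≢-nonZero; toℚᵘ)
open import Data.Rational.Properties
import Data.Rational.Unnormalised as ℚᵘ
import Data.Rational.Unnormalised.Properties as ℚᵘ
open import Data.Fin using (Fin; zero; suc)
open import Data.Fin.Properties using (suc-injective) renaming (_≟_ to _≟F_)
open import Data.Product using (_×_; _,_; proj₁)
open import Data.Product.Properties using (≡-dec)
open import Data.Bool using (Bool; true; false; _∧_; _∨_; not)
open import Data.Bool.Properties using (∨-assoc; ∨-comm; ∨-identityʳ)
open import Data.Empty using (⊥-elim)
open import Function using (_∘_)
open import Level using (0ℓ)
open import Relation.Nullary using (yes; no; does; contradiction)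
open import Relation.Nullary.Decidable using (dec⇒maybe; dec-true; dec-false)
open import Relation.Binary.Definitions using (DecidableEquality)
open import Relation.Binary.PropositionalEquality hiding (J)
open import Tactic.RingSolver using (solve-∀)
open import Tactic.RingSolver.Core.AlmostCommutativeRing
  using (AlmostCommutativeRing; fromCommutativeRing)

ℚ-ring : AlmostCommutativeRing 0ℓ 0ℓ
ℚ-ring = fromCommutativeRing +-*-commutativeRing (λ x → dec⇒maybe (0ℚ ≟ x))

private
  toℚᵘ-ℕ→ℚ : ∀ m → toℚᵘ (ℕ→ℚ m) ℚᵘ.≃ ℚᵘ.mkℚᵘ (+ m) 0
  toℚᵘ-ℕ→ℚ m = toℚᵘ-fromℚᵘ (ℚᵘ.mkℚᵘ (+ m) 0)

ℕ→ℚ-+ : ∀ a b → ℕ→ℚ (a ℕ.+ b) ≡ ℕ→ℚ a + ℕ→ℚ b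
ℕ→ℚ-+ a b = toℚᵘ-injective (ℚᵘ.≃-trans (toℚᵘ-ℕ→ℚ (a ℕ.+ b)) (ℚᵘ.≃-trans (ℚᵘ.*≡* eq)
  (ℚᵘ.≃-sym (ℚᵘ.≃-trans (toℚᵘ-homo-+ (ℕ→ℚ a) (ℕ→ℚ b))
                         (ℚᵘ.+-cong (toℚᵘ-ℕ→ℚ a) (toℚᵘ-ℕ→ℚ b))))))
  where
  eq : + (a ℕ.+ b) ℤ.* + 1 ≡ (+ a ℤ.* + 1 ℤ.+ + b ℤ.* + 1) ℤ.* + 1
  eq rewrite ℤ.*-identityʳ (+ (a ℕ.+ b)) | ℤ.*-identityʳ (+ a) | ℤ.*-identityʳ (+ b)
           | ℤ.*-identityʳ (+ a ℤ.+ + b) = ℤ.pos-+ a b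

ℕ→ℚ-* : ∀ a b → ℕ→ℚ (a ℕ.* b) ≡ ℕ→ℚ a * ℕ→ℚ b
ℕ→ℚ-* a b = toℚᵘ-injective (ℚᵘ.≃-trans (toℚᵘ-ℕ→ℚ (a ℕ.* b)) (ℚᵘ.≃-trans (ℚᵘ.*≡* eq)
  (ℚᵘ.≃-sym (ℚᵘ.≃-trans (toℚᵘ-homo-* (ℕ→ℚ a) (ℕ→ℚ b))
                         (ℚᵘ.*-cong (toℚᵘ-ℕ→ℚ a) (toℚᵘ-ℕ→ℚ b))))))
  where
  eq : + (a ℕ.* b) ℤ.* + 1 ≡ (+ a ℤ.* + b) ℤ.* + 1
  eq rewrite ℤ.*-identityʳ (+ (a ℕ.* b)) | ℤ.*-identityʳ (+ a ℤ.* + b) = ℤ.pos-* a b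

ℕ→ℚ-injective : ∀ a b → ℕ→ℚ a ≡ ℕ→ℚ b → a ≡ b
ℕ→ℚ-injective a b eq
  with ℚᵘ.≃-trans (ℚᵘ.≃-sym (toℚᵘ-ℕ→ℚ a)) (ℚᵘ.≃-trans (toℚᵘ-cong eq) (toℚᵘ-ℕ→ℚ b))
... | ℚᵘ.*≡* z = ℤ.+-injective (trans (sym (ℤ.*-identityʳ (+ a))) (trans z (ℤ.*-identityʳ (+ b))))

ℕ→ℚ-≢ : ∀ {a b} → a ≢ b → ℕ→ℚ a ≢ ℕ→ℚ b
ℕ→ℚ-≢ {a} {b} a≢b = a≢b ∘ ℕ→ℚ-injective a b

frac-inverse : ∀ d → frac (+ 1) (suc d) * ℕ→ℚ (suc d) ≡ 1ℚ
frac-inverse d = toℚᵘ-injective (ℚᵘ.≃-trans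
  (ℚᵘ.≃-trans (toℚᵘ-homo-* (frac (+ 1) (suc d)) (ℕ→ℚ (suc d)))
              (ℚᵘ.*-cong (toℚᵘ-fromℚᵘ (ℚᵘ.mkℚᵘ (+ 1) d)) (toℚᵘ-ℕ→ℚ (suc d))))
  (ℚᵘ.≃-trans (ℚᵘ.*≡* eq) (ℚᵘ.≃-sym (toℚᵘ-ℕ→ℚ 1))))
  where
  eq : (+ 1 ℤ.* + suc d) ℤ.* + 1 ≡ + 1 ℤ.* + suc (d ℕ.* 1)
  eq rewrite ℕ.*-identityʳ d | ℤ.*-identityʳ (+ 1 ℤ.* + suc d) = refl

inverse-unique : ∀ {x y z} → x * z ≡ 1ℚ → y * z ≡ 1ℚ → x ≡ y
inverse-unique {x} {y} {z} xz yz = begin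
  x              ≡⟨ *-identityʳ x ⟨
  x * 1ℚ         ≡⟨ cong (x *_) (sym yz) ⟩
  x * (y * z)    ≡⟨ swap x y z ⟩
  y * (x * z)    ≡⟨ cong (y *_) xz ⟩
  y * 1ℚ         ≡⟨ *-identityʳ y ⟩
  y              ∎
  where
  open ≡-Reasoning
  swap : ∀ x y z → x * (y * z) ≡ y * (x * z)
  swap = solve-∀ ℚ-ring

frac-cancelˡ : ∀ k d → ℕ→ℚ (suc k) * frac (+ 1) (suc k ℕ.* suc d) ≡ frac (+ 1) (suc d)
frac-cancelˡ k d = inverse-unique (begin
  k′ * q * d′                ≡⟨ cong (_* d′) (*-comm k′ q) ⟩
  q * k′ * d′                ≡⟨ *-assoc q k′ d′ ⟩
  q * (k′ * d′)              ≡⟨ cong (q *_) (ℕ→ℚ-* (suc k) (suc d)) ⟨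
  q * ℕ→ℚ (suc k ℕ.* suc d)  ≡⟨ frac-inverse (d ℕ.+ k ℕ.* suc d) ⟩
  1ℚ                         ∎) (frac-inverse d)
  where
  open ≡-Reasoning
  k′ d′ q : ℚ
  k′ = ℕ→ℚ (suc k)
  d′ = ℕ→ℚ (suc d)
  q = frac (+ 1) (suc k ℕ.* suc d)

does-sym : ∀ {A : Set} (_≟_ : DecidableEquality A) (x y : A) → does (x ≟ y) ≡ does (y ≟ x)
does-sym _≟_ x y with x ≟ y
... | yes refl = sym (dec-true (x ≟ x) refl)
... | no x≢y  = sym (dec-false (y ≟ x) (x≢y ∘ sym))

ind-∧ : ∀ p q → ind (p ∧ q) ≡ ind p * ind q
ind-∧ true  q = sym (*-identityˡ (ind q))
ind-∧ false q = sym (*-zeroˡ (ind q))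

δ : ∀ {m} → Fin m → Fin m → ℚ
δ x y = ind (does (x ≟F y))

δ-sym : ∀ {m} (x y : Fin m) → δ x y ≡ δ y x
δ-sym x y = cong ind (does-sym _≟F_ x y)

δ-∨false : ∀ {m} (x y : Fin m) → ind (does (x ≟F y) ∨ false) ≡ δ x y
δ-∨false x y = cong ind (∨-identityʳ (does (x ≟F y)))

δ-disjoint : ∀ {m} {β k : Fin m} → β ≢ k → ∀ k′ → δ β k′ * δ k k′ ≡ 0ℚ
δ-disjoint {β = β} {k} β≢k k′ with β ≟F k′ | k ≟F k′
... | yes refl | yes refl = ⊥-elim (β≢k refl)
... | yes _    | no _     = refl
... | no _     | yes _    = refl
... | no _     | no _     = refl

sumFin-cong : ∀ {m} {f g : Fin m → ℚ} → (∀ i → f i ≡ g i) → sumFin f ≡ sumFin g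
sumFin-cong {zero}  f≗g = refl
sumFin-cong {suc m} f≗g = cong₂ _+_ (f≗g zero) (sumFin-cong (f≗g ∘ suc))

sumFin-+ : ∀ {m} (f g : Fin m → ℚ) → sumFin (λ i → f i + g i) ≡ sumFin f + sumFin g
sumFin-+ {zero}  f g = refl
sumFin-+ {suc m} f g = trans (cong (_+_ (f zero + g zero)) (sumFin-+ (f ∘ suc) (g ∘ suc)))
  (+-interchange (f zero) (g zero) (sumFin (f ∘ suc)) (sumFin (g ∘ suc)))
  where +-interchange : ∀ a b c d → (a + b) + (c + d) ≡ (a + c) + (b + d)
        +-interchange = solve-∀ ℚ-ring

sumFin-*ˡ : ∀ {m} (c : ℚ) (f : Fin m → ℚ) → sumFin (λ i → c * f i) ≡ c * sumFin f
sumFin-*ˡ {zero}  c f = sym (*-zeroʳ c)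
sumFin-*ˡ {suc m} c f = trans (cong (_+_ (c * f zero)) (sumFin-*ˡ c (f ∘ suc)))
  (sym (*-distribˡ-+ c (f zero) _))

sumFin-const : ∀ {m} (c : ℚ) → sumFin {m} (λ _ → c) ≡ ℕ→ℚ m * c
sumFin-const {zero}  c = sym (*-zeroˡ c)
sumFin-const {suc m} c = begin
  c + sumFin {m} (λ _ → c)  ≡⟨ cong (_+_ c) (sumFin-const {m} c) ⟩
  c + ℕ→ℚ m * c             ≡⟨ factor c (ℕ→ℚ m) ⟩
  (1ℚ + ℕ→ℚ m) * c          ≡⟨ cong (_* c) (sym (ℕ→ℚ-+ 1 m)) ⟩
  ℕ→ℚ (suc m) * c           ∎
  where
  open ≡-Reasoning
  factor : ∀ c x → c + x * c ≡ (1ℚ + x) * c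
  factor = solve-∀ ℚ-ring

sumFin-0 : ∀ {m} → sumFin {m} (λ _ → 0ℚ) ≡ 0ℚ
sumFin-0 {m} = trans (sumFin-const {m} 0ℚ) (*-zeroʳ (ℕ→ℚ m))

sumFin-swap : ∀ {m k} (F : Fin m → Fin k → ℚ) →
  sumFin (λ i → sumFin (λ j → F i j)) ≡ sumFin (λ j → sumFin (λ i → F i j))
sumFin-swap {zero}  {k} F = sym (sumFin-0 {k})
sumFin-swap {suc m} {k} F = trans (cong (_+_ (sumFin (F zero))) (sumFin-swap (F ∘ suc)))
  (sym (sumFin-+ (F zero) (λ j → sumFin (λ i → F (suc i) j))))

sumFin-δ : ∀ {m} (c : Fin m) (F : Fin m → ℚ) → sumFin (λ x → δ c x * F x) ≡ F c
sumFin-δ {suc m} zero F = begin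
  1ℚ * F zero + sumFin (λ x → 0ℚ * F (suc x))  ≡⟨ cong₂ _+_ (*-identityˡ (F zero))
                                                    (trans (sumFin-cong (λ x → *-zeroˡ (F (suc x)))) (sumFin-0 {m})) ⟩
  F zero + 0ℚ                                  ≡⟨ +-identityʳ (F zero) ⟩
  F zero                                       ∎
  where open ≡-Reasoning
sumFin-δ {suc m} (suc c) F =
  trans (cong₂ _+_ (*-zeroˡ (F zero)) (sumFin-δ c (F ∘ suc))) (+-identityˡ (F (suc c)))

sumFin-δˡ : ∀ {m} (c : Fin m) (F : Fin m → ℚ) → sumFin (λ x → δ x c * F x) ≡ F c
sumFin-δˡ c F = trans (sumFin-cong (λ x → cong (_* F x) (δ-sym x c))) (sumFin-δ c F)

sumFin-only : ∀ {m} (x : Fin m → ℚ) (i : Fin m) → (∀ j → j ≢ i → x j ≡ 0ℚ) → sumFin x ≡ x i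
sumFin-only {suc m} x zero others =
  trans (cong (_+_ (x zero)) (trans (sumFin-cong (λ j → others (suc j) λ ())) (sumFin-0 {m})))
        (+-identityʳ (x zero))
sumFin-only {suc m} x (suc i) others =
  trans (cong₂ _+_ (others zero λ ()) (sumFin-only (x ∘ suc) i (λ j j≢i → others (suc j) (j≢i ∘ suc-injective))))
        (+-identityˡ (x (suc i)))

sumFin-- : ∀ {m} (f g : Fin m → ℚ) → sumFin (λ i → f i - g i) ≡ sumFin f - sumFin g
sumFin-- f g = begin
  sumFin (λ i → f i - g i)               ≡⟨ sumFin-cong (λ i → as-sum (f i) (g i)) ⟩
  sumFin (λ i → f i + - 1ℚ * g i)        ≡⟨ sumFin-+ f (λ i → - 1ℚ * g i) ⟩
  sumFin f + sumFin (λ i → - 1ℚ * g i)   ≡⟨ cong (_+_ (sumFin f)) (sumFin-*ˡ (- 1ℚ) g) ⟩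
  sumFin f + - 1ℚ * sumFin g             ≡⟨ as-sum (sumFin f) (sumFin g) ⟨
  sumFin f - sumFin g                    ∎
  where
  open ≡-Reasoning
  as-sum : ∀ x y → x - y ≡ x + - 1ℚ * y
  as-sum = solve-∀ ℚ-ring

ax≡bx⇒x≡0 : ∀ {a b x : ℚ} → a ≢ b → a * x ≡ b * x → x ≡ 0ℚ
ax≡bx⇒x≡0 {a} {b} {x} a≢b ax≡bx with x ≟ 0ℚ
... | yes x≡0 = x≡0
... | no x≢0 = contradiction (trans (sym (unscale a)) (trans (cong (_* 1/ x) ax≡bx) (unscale b))) a≢b
  where
  instance _ = ≢-nonZero x≢0
  unscale : ∀ c → c * x * 1/ x ≡ c
  unscale c = trans (*-assoc c x (1/ x)) (trans (cong (c *_) (*-inverseʳ x)) (*-identityʳ c))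

module _ {n : ℕ} where

  sumE-cong : {f g : Edge n → ℚ} → (∀ e → f e ≡ g e) → sumE f ≡ sumE g
  sumE-cong f≗g = sumFin-cong λ k → sumFin-cong λ a → sumFin-cong λ b → f≗g (k , a , b)

  sumE-+ : (f g : Edge n → ℚ) → sumE (λ e → f e + g e) ≡ sumE f + sumE g
  sumE-+ f g = trans
    (sumFin-cong λ k → trans
      (sumFin-cong λ a → sumFin-+ (λ b → f (k , a , b)) (λ b → g (k , a , b)))
      (sumFin-+ (λ a → sumFin λ b → f (k , a , b)) (λ a → sumFin λ b → g (k , a , b))))
    (sumFin-+ (λ k → sumFin λ a → sumFin λ b → f (k , a , b)) (λ k → sumFin λ a → sumFin λ b → g (k , a , b)))

  sumE-*ˡ : (c : ℚ) (f : Edge n → ℚ) → sumE (λ e → c * f e) ≡ c * sumE f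
  sumE-*ˡ c f = trans
    (sumFin-cong λ k → trans
      (sumFin-cong λ a → sumFin-*ˡ c (λ b → f (k , a , b)))
      (sumFin-*ˡ c (λ a → sumFin λ b → f (k , a , b))))
    (sumFin-*ˡ c (λ k → sumFin λ a → sumFin λ b → f (k , a , b)))

  sumE-linear : (α β : ℚ) (f g : Edge n → ℚ) →
    sumE (λ e → α * f e + β * g e) ≡ α * sumE f + β * sumE g
  sumE-linear α β f g =
    trans (sumE-+ (λ e → α * f e) (λ e → β * g e)) (cong₂ _+_ (sumE-*ˡ α f) (sumE-*ˡ β g))

  sumE-- : (f g : Edge n → ℚ) → sumE (λ e → f e - g e) ≡ sumE f - sumE g
  sumE-- f g = begin
    sumE (λ e → f e - g e)                    ≡⟨ sumE-cong (λ e → as-combination (f e) (g e)) ⟩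
    sumE (λ e → 1ℚ * f e + - 1ℚ * g e)        ≡⟨ sumE-linear 1ℚ (- 1ℚ) f g ⟩
    1ℚ * sumE f + - 1ℚ * sumE g               ≡⟨ as-combination (sumE f) (sumE g) ⟨
    sumE f - sumE g                           ∎
    where
    open ≡-Reasoning
    as-combination : ∀ x y → x - y ≡ 1ℚ * x + - 1ℚ * y
    as-combination = solve-∀ ℚ-ring

  private
    sumFin-sumE-swap : ∀ {m} (F : Fin m → Edge n → ℚ) →
      sumFin (λ i → sumE (F i)) ≡ sumE (λ h → sumFin (λ i → F i h))
    sumFin-sumE-swap F =
      trans (sumFin-swap (λ i k → sumFin λ a → sumFin λ b → F i (k , a , b)))
      (sumFin-cong λ k → trans (sumFin-swap (λ i a → sumFin λ b → F i (k , a , b)))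
      (sumFin-cong λ a → sumFin-swap (λ i b → F i (k , a , b))))

  sumE-swap : (F : Edge n → Edge n → ℚ) →
    sumE (λ g → sumE (F g)) ≡ sumE (λ h → sumE (λ g → F g h))
  sumE-swap F = trans
    (sumFin-cong λ k → trans
      (sumFin-cong λ a → sumFin-sumE-swap (λ b → F (k , a , b)))
      (sumFin-sumE-swap (λ a h → sumFin λ b → F (k , a , b) h)))
    (sumFin-sumE-swap (λ k h → sumFin λ a → sumFin λ b → F (k , a , b) h))

  sumE-I : (e : Edge n) (F : Edge n → ℚ) → sumE (λ g → I e g * F g) ≡ F e
  sumE-I (k , a , b) F = begin
    sumE (λ g → I (k , a , b) g * F g)
      ≡⟨ sumE-cong (λ (k′ , a′ , b′) →
           split-δ (does (k ≟F k′)) (does (a ≟F a′)) (does (b ≟F b′)) (F (k′ , a′ , b′))) ⟩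
    sumFin (λ k′ → sumFin (λ a′ → sumFin (λ b′ → δ k k′ * (δ a a′ * (δ b b′ * F (k′ , a′ , b′))))))
      ≡⟨ sumFin-cong (λ k′ → sumFin-cong (λ a′ → trans
           (sumFin-cong (λ b′ → sym (*-assoc (δ k k′) (δ a a′) (δ b b′ * F (k′ , a′ , b′)))))
           (trans (pull (δ k k′ * δ a a′) b (λ b′ → F (k′ , a′ , b′)))
                  (*-assoc (δ k k′) (δ a a′) (F (k′ , a′ , b)))))) ⟩
    sumFin (λ k′ → sumFin (λ a′ → δ k k′ * (δ a a′ * F (k′ , a′ , b))))
      ≡⟨ sumFin-cong (λ k′ → pull (δ k k′) a (λ a′ → F (k′ , a′ , b))) ⟩
    sumFin (λ k′ → δ k k′ * F (k′ , a , b))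
      ≡⟨ sumFin-δ k (λ k′ → F (k′ , a , b)) ⟩
    F (k , a , b) ∎
    where
    open ≡-Reasoning
    split-δ : ∀ p q r x → ind (p ∧ q ∧ r) * x ≡ ind p * (ind q * (ind r * x))
    split-δ true  q r x = trans (cong (_* x) (ind-∧ q r))
      (trans (*-assoc (ind q) (ind r) x) (sym (*-identityˡ _)))
    split-δ false q r x = trans (*-zeroˡ x) (sym (*-zeroˡ (ind q * (ind r * x))))
    pull : ∀ {m} (c : ℚ) (d : Fin m) (G : Fin m → ℚ) →
      sumFin (λ x → c * (δ d x * G x)) ≡ c * G d
    pull c d G = trans (sumFin-*ˡ c (λ x → δ d x * G x)) (cong (c *_) (sumFin-δ d G))

  infix 4 _≈_
  _≈_ : Mat n → Mat n → Set
  P ≈ Q = ∀ e f → P e f ≡ Q e f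

  IsSymmetric : Mat n → Set
  IsSymmetric P = ∀ e f → P e f ≡ P f e

  ·v-congˡ : {P Q : Mat n} → P ≈ Q → (x : Vect n) → ∀ e → (P ·v x) e ≡ (Q ·v x) e
  ·v-congˡ P≈Q x e = sumE-cong λ g → cong (_* x g) (P≈Q e g)

  ·v-congʳ : (P : Mat n) {x y : Vect n} → (∀ e → x e ≡ y e) → ∀ e → (P ·v x) e ≡ (P ·v y) e
  ·v-congʳ P x≗y e = sumE-cong λ g → cong (P e g *_) (x≗y g)

  ·v-assoc : (P Q : Mat n) (x : Vect n) → ∀ e → ((P · Q) ·v x) e ≡ (P ·v (Q ·v x)) e
  ·v-assoc P Q x e = begin
    sumE (λ h → sumE (λ g → P e g * Q g h) * x h)
      ≡⟨ sumE-cong (λ h → trans (*-comm _ (x h)) (sym (sumE-*ˡ (x h) (λ g → P e g * Q g h)))) ⟩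
    sumE (λ h → sumE (λ g → x h * (P e g * Q g h)))
      ≡⟨ sumE-swap (λ h g → x h * (P e g * Q g h)) ⟩
    sumE (λ g → sumE (λ h → x h * (P e g * Q g h)))
      ≡⟨ sumE-cong (λ g → trans (sumE-cong (λ h → rearrange (x h) (P e g) (Q g h)))
                                  (sumE-*ˡ (P e g) (λ h → Q g h * x h))) ⟩
    sumE (λ g → P e g * sumE (λ h → Q g h * x h)) ∎
    where
    open ≡-Reasoning
    rearrange : ∀ a b c → a * (b * c) ≡ b * (c * a)
    rearrange = solve-∀ ℚ-ring

  ·v-scale : (P : Mat n) (c : ℚ) (x : Vect n) → ∀ e → (P ·v (λ f → c * x f)) e ≡ c * (P ·v x) e
  ·v-scale P c x e = trans (sumE-cong λ g → rearrange (P e g) c (x g)) (sumE-*ˡ c (λ g → P e g * x g))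
    where
    rearrange : ∀ p c x → p * (c * x) ≡ c * (p * x)
    rearrange = solve-∀ ℚ-ring

  ⊛-·v : (c : ℚ) (P : Mat n) (x : Vect n) → ∀ e → ((c ⊛ P) ·v x) e ≡ c * (P ·v x) e
  ⊛-·v c P x e = trans (sumE-cong λ g → *-assoc c (P e g) (x g)) (sumE-*ˡ c (λ g → P e g * x g))

  ⊖-·v : (P Q : Mat n) (x : Vect n) → ∀ e → ((P ⊖ Q) ·v x) e ≡ (P ·v x) e - (Q ·v x) e
  ⊖-·v P Q x e = trans (sumE-cong λ g → distrib (P e g) (Q e g) (x g))
                       (sumE-- (λ g → P e g * x g) (λ g → Q e g * x g))
    where
    distrib : ∀ p q x → (p - q) * x ≡ p * x - q * x
    distrib = solve-∀ ℚ-ring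

  ·-⊖ : (P X Y : Mat n) → (P · (X ⊖ Y)) ≈ ((P · X) ⊖ (P · Y))
  ·-⊖ P X Y e f = trans (sumE-cong λ g → distrib (P e g) (X g f) (Y g f))
                        (sumE-- (λ g → P e g * X g f) (λ g → P e g * Y g f))
    where
    distrib : ∀ p x y → p * (x - y) ≡ p * x - p * y
    distrib = solve-∀ ℚ-ring

  I-·v : (x : Vect n) → ∀ e → (I ·v x) e ≡ x e
  I-·v x e = sumE-I e x

  I-symmetric : IsSymmetric I
  I-symmetric (k , a , b) (k′ , a′ , b′) =
    cong ind (cong₂ _∧_ (does-sym _≟F_ k k′) (cong₂ _∧_ (does-sym _≟F_ a a′) (does-sym _≟F_ b b′)))

  ·v-column : (P : Mat n) (f : Edge n) → ∀ e → (P ·v (λ g → I g f)) e ≡ P e f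
  ·v-column P f e = trans (sumE-cong λ g → trans (*-comm (P e g) (I g f)) (cong (_* P e g) (I-symmetric g f)))
                          (sumE-I f (P e))

  ·-transpose : {P Q : Mat n} → IsSymmetric P → IsSymmetric Q → ∀ e f → (P · Q) e f ≡ (Q · P) f e
  ·-transpose {P} {Q} P-sym Q-sym e f =
    sumE-cong λ g → trans (*-comm (P e g) (Q g f)) (cong₂ _*_ (Q-sym g f) (P-sym e g))

module _ {n : ℕ} (M : Mat n) where

  eigen-range : (P : Mat n) {λ′ : ℚ} → (M · P) ≈ (λ′ ⊛ P) → ∀ x → Eigenspace M λ′ (P ·v x)
  eigen-range P {λ′} MP x e = begin
    (M ·v (P ·v x)) e   ≡⟨ ·v-assoc M P x e ⟨
    ((M · P) ·v x) e    ≡⟨ ·v-congˡ MP x e ⟩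
    ((λ′ ⊛ P) ·v x) e   ≡⟨ ⊛-·v λ′ P x e ⟩
    λ′ * (P ·v x) e     ∎
    where open ≡-Reasoning

  -- P kills the μ-eigenvectors of M because, both being symmetric, P · M ≈ λ′ ⊛ P as well.
  eigen-orthogonal : IsSymmetric M → {P : Mat n} {λ′ μ : ℚ} → IsSymmetric P →
    (M · P) ≈ (λ′ ⊛ P) → λ′ ≢ μ → ∀ {v} → Eigenspace M μ v → ∀ e → (P ·v v) e ≡ 0ℚ
  eigen-orthogonal M-sym {P} {λ′} {μ} P-sym MP λ′≢μ {v} Mv≡μv e = ax≡bx⇒x≡0 λ′≢μ (begin
    λ′ * (P ·v v) e            ≡⟨ ⊛-·v λ′ P v e ⟨
    ((λ′ ⊛ P) ·v v) e          ≡⟨ ·v-congˡ PM v e ⟨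
    ((P · M) ·v v) e           ≡⟨ ·v-assoc P M v e ⟩
    (P ·v (M ·v v)) e          ≡⟨ ·v-congʳ P Mv≡μv e ⟩
    (P ·v (λ f → μ * v f)) e   ≡⟨ ·v-scale P μ v e ⟩
    μ * (P ·v v) e             ∎)
    where
    open ≡-Reasoning
    PM : (P · M) ≈ (λ′ ⊛ P)
    PM e f = trans (·-transpose P-sym M-sym e f) (trans (MP f e) (cong (λ′ *_) (P-sym f e)))

  eigenprojection : {P : Mat n} {λ′ : ℚ} → IsSymmetric P → (M · P) ≈ (λ′ ⊛ P) →
    (∀ {v} → Eigenspace M λ′ v → ∀ e → (P ·v v) e ≡ v e) → IsOrthProjOnto P (Eigenspace M λ′)
  eigenprojection {P} {λ′} P-sym MP fixes =
    idempotent , P-sym , eigen-range P {λ′} MP , λ v Mv≡λv → v , fixes Mv≡λv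
    where
    open ≡-Reasoning
    idempotent : ∀ e f → (P · P) e f ≡ P e f
    idempotent e f = begin
      (P ·v (λ g → P g f)) e                ≡⟨ ·v-congʳ P (·v-column P f) e ⟨
      (P ·v (P ·v (λ g → I g f))) e         ≡⟨ fixes (eigen-range P {λ′} MP (λ g → I g f)) e ⟩
      (P ·v (λ g → I g f)) e                ≡⟨ ·v-column P f e ⟩
      P e f                                 ∎

IsOrthProjOnto-cong : ∀ {n} {P : Mat n} {V W : Vect n → Set} →
  (∀ v → V v → W v) → (∀ v → W v → V v) → IsOrthProjOnto P V → IsOrthProjOnto P W
IsOrthProjOnto-cong V⊆W W⊆V (idem , sym , range , onto) =
  idem , sym , (λ x → V⊆W _ (range x)) , (λ v w → onto v (W⊆V v w))

module SpectralResolution {n : ℕ} {M P₀ P₁ P₂ : Mat n} {λ₀ λ₁ λ₂ : ℚ}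
  (M-sym : IsSymmetric M)
  (P₀-sym : IsSymmetric P₀) (P₁-sym : IsSymmetric P₁) (P₂-sym : IsSymmetric P₂)
  (MP₀ : (M · P₀) ≈ (λ₀ ⊛ P₀)) (MP₁ : (M · P₁) ≈ (λ₁ ⊛ P₁)) (MP₂ : (M · P₂) ≈ (λ₂ ⊛ P₂))
  (M-resolution : ∀ e f → M e f ≡ λ₀ * P₀ e f + λ₁ * P₁ e f + λ₂ * P₂ e f)
  (λ₀≢λ₁ : λ₀ ≢ λ₁) (λ₀≢λ₂ : λ₀ ≢ λ₂) (λ₁≢λ₂ : λ₁ ≢ λ₂)
  (λ₀≢0 : λ₀ ≢ 0ℚ) (λ₁≢0 : λ₁ ≢ 0ℚ) (λ₂≢0 : λ₂ ≢ 0ℚ)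
  where

  Q : Mat n
  Q = ((I ⊖ P₀) ⊖ P₁) ⊖ P₂

  private
    open ≡-Reasoning

    Q-sym : IsSymmetric Q
    Q-sym e f = cong₂ _-_ (cong₂ _-_ (cong₂ _-_ (I-symmetric e f) (P₀-sym e f)) (P₁-sym e f)) (P₂-sym e f)

    Q-·v : (v : Vect n) → ∀ e → (Q ·v v) e ≡ v e - (P₀ ·v v) e - (P₁ ·v v) e - (P₂ ·v v) e
    Q-·v v e = begin
      (Q ·v v) e
        ≡⟨ ⊖-·v ((I ⊖ P₀) ⊖ P₁) P₂ v e ⟩
      (((I ⊖ P₀) ⊖ P₁) ·v v) e - (P₂ ·v v) e
        ≡⟨ cong (_- (P₂ ·v v) e) (⊖-·v (I ⊖ P₀) P₁ v e) ⟩
      ((I ⊖ P₀) ·v v) e - (P₁ ·v v) e - (P₂ ·v v) e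
        ≡⟨ cong (λ z → z - (P₁ ·v v) e - (P₂ ·v v) e) (⊖-·v I P₀ v e) ⟩
      (I ·v v) e - (P₀ ·v v) e - (P₁ ·v v) e - (P₂ ·v v) e
        ≡⟨ cong (λ z → z - (P₀ ·v v) e - (P₁ ·v v) e - (P₂ ·v v) e) (I-·v v e) ⟩
      v e - (P₀ ·v v) e - (P₁ ·v v) e - (P₂ ·v v) e ∎

    MQ : (M · Q) ≈ (0ℚ ⊛ Q)
    MQ e f = begin
      (M · Q) e f
        ≡⟨ ·-⊖ M ((I ⊖ P₀) ⊖ P₁) P₂ e f ⟩
      (M · ((I ⊖ P₀) ⊖ P₁)) e f - (M · P₂) e f
        ≡⟨ cong (_- (M · P₂) e f) (·-⊖ M (I ⊖ P₀) P₁ e f) ⟩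
      (M · (I ⊖ P₀)) e f - (M · P₁) e f - (M · P₂) e f
        ≡⟨ cong (λ z → z - (M · P₁) e f - (M · P₂) e f) (·-⊖ M I P₀ e f) ⟩
      (M · I) e f - (M · P₀) e f - (M · P₁) e f - (M · P₂) e f
        ≡⟨ cong₂ (λ x y → x - y - (M · P₁) e f - (M · P₂) e f) (·v-column M f e) (MP₀ e f) ⟩
      M e f - λ₀ * P₀ e f - (M · P₁) e f - (M · P₂) e f
        ≡⟨ cong₂ (λ x y → M e f - λ₀ * P₀ e f - x - y) (MP₁ e f) (MP₂ e f) ⟩
      M e f - λ₀ * P₀ e f - λ₁ * P₁ e f - λ₂ * P₂ e f
        ≡⟨ cong (λ z → z - λ₀ * P₀ e f - λ₁ * P₁ e f - λ₂ * P₂ e f) (M-resolution e f) ⟩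
      λ₀ * P₀ e f + λ₁ * P₁ e f + λ₂ * P₂ e f - λ₀ * P₀ e f - λ₁ * P₁ e f - λ₂ * P₂ e f
        ≡⟨ cancels λ₀ λ₁ λ₂ (P₀ e f) (P₁ e f) (P₂ e f) (Q e f) ⟩
      0ℚ * Q e f ∎
      where
      cancels : ∀ λ₀ λ₁ λ₂ p₀ p₁ p₂ q →
        λ₀ * p₀ + λ₁ * p₁ + λ₂ * p₂ - λ₀ * p₀ - λ₁ * p₁ - λ₂ * p₂ ≡ 0ℚ * q
      cancels = solve-∀ ℚ-ring

    piece : Fin 4 → Mat n
    piece zero                   = Q
    piece (suc zero)             = P₀
    piece (suc (suc zero))       = P₁
    piece (suc (suc (suc zero))) = P₂

    eigenvalue : Fin 4 → ℚ
    eigenvalue zero                   = 0ℚ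
    eigenvalue (suc zero)             = λ₀
    eigenvalue (suc (suc zero))       = λ₁
    eigenvalue (suc (suc (suc zero))) = λ₂

    piece-sym : ∀ i → IsSymmetric (piece i)
    piece-sym zero                   = Q-sym
    piece-sym (suc zero)             = P₀-sym
    piece-sym (suc (suc zero))       = P₁-sym
    piece-sym (suc (suc (suc zero))) = P₂-sym

    M-piece : ∀ i → (M · piece i) ≈ (eigenvalue i ⊛ piece i)
    M-piece zero                   = MQ
    M-piece (suc zero)             = MP₀
    M-piece (suc (suc zero))       = MP₁
    M-piece (suc (suc (suc zero))) = MP₂

    eigenvalue-injective : ∀ {i j} → eigenvalue i ≡ eigenvalue j → i ≡ j
    eigenvalue-injective {zero}                   {zero}                   _ = refl
    eigenvalue-injective {zero}                   {suc zero}               p = ⊥-elim (λ₀≢0 (sym p))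
    eigenvalue-injective {zero}                   {suc (suc zero)}         p = ⊥-elim (λ₁≢0 (sym p))
    eigenvalue-injective {zero}                   {suc (suc (suc zero))}   p = ⊥-elim (λ₂≢0 (sym p))
    eigenvalue-injective {suc zero}               {zero}                   p = ⊥-elim (λ₀≢0 p)
    eigenvalue-injective {suc zero}               {suc zero}               _ = refl
    eigenvalue-injective {suc zero}               {suc (suc zero)}         p = ⊥-elim (λ₀≢λ₁ p)
    eigenvalue-injective {suc zero}               {suc (suc (suc zero))}   p = ⊥-elim (λ₀≢λ₂ p)
    eigenvalue-injective {suc (suc zero)}         {zero}                   p = ⊥-elim (λ₁≢0 p)
    eigenvalue-injective {suc (suc zero)}         {suc zero}               p = ⊥-elim (λ₀≢λ₁ (sym p))
    eigenvalue-injective {suc (suc zero)}         {suc (suc zero)}         _ = refl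
    eigenvalue-injective {suc (suc zero)}         {suc (suc (suc zero))}   p = ⊥-elim (λ₁≢λ₂ p)
    eigenvalue-injective {suc (suc (suc zero))}   {zero}                   p = ⊥-elim (λ₂≢0 p)
    eigenvalue-injective {suc (suc (suc zero))}   {suc zero}               p = ⊥-elim (λ₀≢λ₂ (sym p))
    eigenvalue-injective {suc (suc (suc zero))}   {suc (suc zero)}         p = ⊥-elim (λ₁≢λ₂ (sym p))
    eigenvalue-injective {suc (suc (suc zero))}   {suc (suc (suc zero))}   _ = refl

    resolution : (v : Vect n) → ∀ e → v e ≡ sumFin (λ i → (piece i ·v v) e)
    resolution v e = trans (regroup (v e) ((P₀ ·v v) e) ((P₁ ·v v) e) ((P₂ ·v v) e))
                           (cong (λ q → q + ((P₀ ·v v) e + ((P₁ ·v v) e + ((P₂ ·v v) e + 0ℚ)))) (sym (Q-·v v e)))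
      where
      regroup : ∀ v a b c → v ≡ (v - a - b - c) + (a + (b + (c + 0ℚ)))
      regroup = solve-∀ ℚ-ring

    -- v is the sum of its four pieces, and on an eigenvector the pieces of the
    -- other eigenvalues vanish.
    piece-fixes : ∀ i {v} → Eigenspace M (eigenvalue i) v → ∀ e → (piece i ·v v) e ≡ v e
    piece-fixes i {v} Mv≡λv e = sym (trans (resolution v e) (sumFin-only (λ j → (piece j ·v v) e) i
      λ j j≢i → eigen-orthogonal M M-sym {piece j} {eigenvalue j} {eigenvalue i}
                  (piece-sym j) (M-piece j) (j≢i ∘ eigenvalue-injective) Mv≡λv e))

    piece-projection : ∀ i → IsOrthProjOnto (piece i) (Eigenspace M (eigenvalue i))
    piece-projection i = eigenprojection M {piece i} {eigenvalue i} (piece-sym i) (M-piece i) (piece-fixes i)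

  P₀-projection : IsOrthProjOnto P₀ (Eigenspace M λ₀)
  P₀-projection = piece-projection (suc zero)

  P₁-projection : IsOrthProjOnto P₁ (Eigenspace M λ₁)
  P₁-projection = piece-projection (suc (suc zero))

  P₂-projection : IsOrthProjOnto P₂ (Eigenspace M λ₂)
  P₂-projection = piece-projection (suc (suc (suc zero)))

  Q-projection : IsOrthProjOnto Q (Kernel M)
  Q-projection = IsOrthProjOnto-cong (λ v Mv≡0v e → trans (Mv≡0v e) (*-zeroˡ (v e)))
                                     (λ v Mv≡0 e → trans (Mv≡0 e) (sym (*-zeroˡ (v e))))
                                     (piece-projection zero)

module _ {n : ℕ} where

  private
    ν : ℚ
    ν = ℕ→ℚ n

  -- fanᵢ (k , a , b) x joins the endpoint endᵢ of the edge to the vertex (k , x)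
  -- of the part it misses; these are its A′₃-neighbours.

  fan₁ fan₂ : Edge n → Fin n → Edge n
  fan₁ (zero             , a , b) x = suc (suc zero) , x , a
  fan₁ (suc zero         , a , b) x = suc (suc zero) , a , x
  fan₁ (suc (suc zero)   , a , b) x = suc zero       , a , x
  fan₂ (zero             , a , b) x = suc zero       , x , b
  fan₂ (suc zero         , a , b) x = zero           , x , b
  fan₂ (suc (suc zero)   , a , b) x = zero           , b , x

  private
    sum₂-0 : (G : Fin n → Fin n → ℚ) → sumFin (λ x → sumFin (λ y → 0ℚ * G x y)) ≡ 0ℚ
    sum₂-0 G = trans (sumFin-cong λ x → trans (sumFin-cong λ y → *-zeroˡ (G x y)) (sumFin-0 {n})) (sumFin-0 {n})

    sum₂-δʳ : (c : Fin n) (w : Fin n → ℚ) → (∀ y → w y ≡ δ c y) → (G : Fin n → Fin n → ℚ) →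
      sumFin (λ x → sumFin (λ y → w y * G x y)) ≡ sumFin (λ x → G x c)
    sum₂-δʳ c w w≗δ G = sumFin-cong λ x →
      trans (sumFin-cong λ y → cong (_* G x y) (w≗δ y)) (sumFin-δ c (G x))

    sum₂-δˡ : (c : Fin n) (w : Fin n → ℚ) → (∀ x → w x ≡ δ c x) → (G : Fin n → Fin n → ℚ) →
      sumFin (λ x → sumFin (λ y → w x * G x y)) ≡ sumFin (λ y → G c y)
    sum₂-δˡ c w w≗δ G = trans
      (sumFin-cong λ x → trans (sumFin-*ˡ (w x) (G x)) (cong (_* sumFin (G x)) (w≗δ x)))
      (sumFin-δ c (λ x → sumFin (G x)))

    gather : ∀ {s₀ s₁ s₂ t₀ t₁ t₂} → s₀ ≡ t₀ → s₁ ≡ t₁ → s₂ ≡ t₂ →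
      s₀ + (s₁ + (s₂ + 0ℚ)) ≡ t₀ + t₁ + t₂
    gather {t₀ = t₀} {t₁} {t₂} refl refl refl = reassoc t₀ t₁ t₂
      where
      reassoc : ∀ a b c → a + (b + (c + 0ℚ)) ≡ a + b + c
      reassoc = solve-∀ ℚ-ring

  A′₃-·-fans : (X : Mat n) (e f : Edge n) →
    (A′₃ · X) e f ≡ sumFin (λ x → X (fan₁ e x) f) + sumFin (λ x → X (fan₂ e x) f)
  A′₃-·-fans X (zero , a , b) f = trans
    (gather (sum₂-0 λ x y → X (zero , x , y) f)
            (sum₂-δʳ b _ (λ _ → refl) λ x y → X (suc zero , x , y) f)
            (sum₂-δʳ a _ (δ-∨false a) λ x y → X (suc (suc zero) , x , y) f))
    (arrange (sumFin (λ x → X (fan₂ (zero , a , b) x) f))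
             (sumFin (λ x → X (fan₁ (zero , a , b) x) f)))
    where
    arrange : ∀ s t → 0ℚ + s + t ≡ t + s
    arrange = solve-∀ ℚ-ring
  A′₃-·-fans X (suc zero , a , b) f = trans
    (gather (sum₂-δʳ b _ (λ _ → refl) λ x y → X (zero , x , y) f)
            (sum₂-0 λ x y → X (suc zero , x , y) f)
            (sum₂-δˡ a _ (δ-∨false a) λ x y → X (suc (suc zero) , x , y) f))
    (arrange (sumFin (λ x → X (fan₂ (suc zero , a , b) x) f))
             (sumFin (λ x → X (fan₁ (suc zero , a , b) x) f)))
    where
    arrange : ∀ s t → s + 0ℚ + t ≡ t + s
    arrange = solve-∀ ℚ-ring
  A′₃-·-fans X (suc (suc zero) , a , b) f = trans
    (gather (sum₂-δˡ b _ (δ-∨false b) λ x y → X (zero , x , y) f)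
            (sum₂-δˡ a _ (δ-∨false a) λ x y → X (suc zero , x , y) f)
            (sum₂-0 λ x y → X (suc (suc zero) , x , y) f))
    (arrange (sumFin (λ x → X (fan₂ (suc (suc zero) , a , b) x) f))
             (sumFin (λ x → X (fan₁ (suc (suc zero) , a , b) x) f)))
    where
    arrange : ∀ s t → s + t + 0ℚ ≡ t + s
    arrange = solve-∀ ℚ-ring

  -- F₁ = 2n² E₁ and F₂ = n² E₂, expressed by incidences rather than by classes.
  inc : Vertex n → Edge n → ℚ
  inc v f = ind (v ≟V end₁ f) + ind (v ≟V end₂ f)

  common : Mat n
  common e f = inc (end₁ e) f + inc (end₂ e) f

  sameBlock : Mat n
  sameBlock e f = ind (samePair e f)

  J F₁ F₂ : Mat n
  J e f = 1ℚ
  F₁ e f = ν * common e f - (1ℚ + sameBlock e f)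
  F₂ e f = sameBlock e f * ((ν * inc (end₁ e) f - 1ℚ) * (ν * inc (end₂ e) f - 1ℚ))

  -- the edges of block β joining the vertex v to every vertex of part k

  record Pencil (g : Fin n → Edge n) (v : Vertex n) (k β : Fin 3) : Set where
    field
      joins : (h : Vertex n → Vertex n → ℚ) → (∀ u w → h u w ≡ h w u) →
              ∀ x → h (end₁ (g x)) (end₂ (g x)) ≡ h v (k , x)
      block : ∀ x → proj₁ (g x) ≡ β

  fan₁-pencil : ∀ e → Pencil (fan₁ e) (end₁ e) (proj₁ e) (highPart (proj₁ e))
  fan₁-pencil (zero , a , b)           = record { joins = λ h h-sym x → h-sym _ _ ; block = λ _ → refl }
  fan₁-pencil (suc zero , a , b)       = record { joins = λ h h-sym x → refl ; block = λ _ → refl }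
  fan₁-pencil (suc (suc zero) , a , b) = record { joins = λ h h-sym x → refl ; block = λ _ → refl }

  fan₂-pencil : ∀ e → Pencil (fan₂ e) (end₂ e) (proj₁ e) (lowPart (proj₁ e))
  fan₂-pencil (zero , a , b)           = record { joins = λ h h-sym x → h-sym _ _ ; block = λ _ → refl }
  fan₂-pencil (suc zero , a , b)       = record { joins = λ h h-sym x → h-sym _ _ ; block = λ _ → refl }
  fan₂-pencil (suc (suc zero) , a , b) = record { joins = λ h h-sym x → refl ; block = λ _ → refl }

  sum-≟V : ∀ p q (c : Fin n) → sumFin (λ x → ind ((p , x) ≟V (q , c))) ≡ δ p q
  sum-≟V p q c with p ≟F q
  ... | yes refl = trans (sumFin-cong λ x → sym (*-identityʳ (δ x c))) (sumFin-δˡ c (λ _ → 1ℚ))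
  ... | no _     = sumFin-0 {n}

  sum-inc : ∀ p (f : Edge n) → sumFin (λ x → inc (p , x) f) ≡ δ p (lowPart (proj₁ f)) + δ p (highPart (proj₁ f))
  sum-inc p (k′ , a′ , b′) = trans
    (sumFin-+ (λ x → ind ((p , x) ≟V (lowPart k′ , a′))) (λ x → ind ((p , x) ≟V (highPart k′ , b′))))
                                   (cong₂ _+_ (sum-≟V p (lowPart k′) a′) (sum-≟V p (highPart k′) b′))

  -- block k′ meets every part except k′
  parts-partition : ∀ (k k′ : Fin 3) → δ k (lowPart k′) + δ k (highPart k′) ≡ 1ℚ - δ k k′
  parts-partition zero             zero             = refl
  parts-partition zero             (suc zero)       = refl
  parts-partition zero             (suc (suc zero)) = refl
  parts-partition (suc zero)       zero             = refl
  parts-partition (suc zero)       (suc zero)       = refl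
  parts-partition (suc zero)       (suc (suc zero)) = refl
  parts-partition (suc (suc zero)) zero             = refl
  parts-partition (suc (suc zero)) (suc zero)       = refl
  parts-partition (suc (suc zero)) (suc (suc zero)) = refl

  blocks-partition : ∀ (k k′ : Fin 3) → δ (lowPart k) k′ + δ (highPart k) k′ ≡ 1ℚ - δ k k′
  blocks-partition k k′ = begin
    δ (lowPart k) k′ + δ (highPart k) k′  ≡⟨ cong₂ _+_ (δ-sym (lowPart k) k′) (δ-sym (highPart k) k′) ⟩
    δ k′ (lowPart k) + δ k′ (highPart k)  ≡⟨ parts-partition k′ k ⟩
    1ℚ - δ k′ k                           ≡⟨ cong (λ d → 1ℚ - d) (δ-sym k′ k) ⟩
    1ℚ - δ k k′                           ∎
    where open ≡-Reasoning

  module PencilSums {g v k β} (pencil : Pencil g v k β) (f : Edge n) where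
    open Pencil pencil
    open ≡-Reasoning

    private
      k′ = proj₁ f

    sum-common : sumFin (λ x → common (g x) f) ≡ ν * inc v f + (1ℚ - δ k k′)
    sum-common = begin
      sumFin (λ x → common (g x) f)
        ≡⟨ sumFin-cong {n} (joins (λ u w → inc u f + inc w f) (λ u w → +-comm (inc u f) (inc w f))) ⟩
      sumFin (λ x → inc v f + inc (k , x) f)
        ≡⟨ sumFin-+ (λ _ → inc v f) (λ x → inc (k , x) f) ⟩
      sumFin {n} (λ _ → inc v f) + sumFin (λ x → inc (k , x) f)
        ≡⟨ cong₂ _+_ (sumFin-const {n} (inc v f)) (trans (sum-inc k f) (parts-partition k k′)) ⟩
      ν * inc v f + (1ℚ - δ k k′) ∎

    sum-sameBlock : sumFin (λ x → sameBlock (g x) f) ≡ ν * δ β k′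
    sum-sameBlock = trans (sumFin-cong {n} λ x → cong (λ b → δ b k′) (block x)) (sumFin-const {n} (δ β k′))

    sum-F₁ : sumFin (λ x → F₁ (g x) f) ≡ ν * (ν * inc v f + (1ℚ - δ k k′)) - (ν + ν * δ β k′)
    sum-F₁ = begin
      sumFin (λ x → ν * common (g x) f - (1ℚ + sameBlock (g x) f))
        ≡⟨ sumFin-- (λ x → ν * common (g x) f) (λ x → 1ℚ + sameBlock (g x) f) ⟩
      sumFin (λ x → ν * common (g x) f) - sumFin (λ x → 1ℚ + sameBlock (g x) f)
        ≡⟨ cong₂ _-_ (sumFin-*ˡ ν (λ x → common (g x) f)) (sumFin-+ (λ _ → 1ℚ) (λ x → sameBlock (g x) f)) ⟩
      ν * sumFin (λ x → common (g x) f) - (sumFin {n} (λ _ → 1ℚ) + sumFin (λ x → sameBlock (g x) f))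
        ≡⟨ cong₂ (λ s t → ν * s - t) sum-common
                 (cong₂ _+_ (trans (sumFin-const {n} 1ℚ) (*-identityʳ ν)) sum-sameBlock) ⟩
      ν * (ν * inc v f + (1ℚ - δ k k′)) - (ν + ν * δ β k′) ∎

    sum-F₂ : β ≢ k → sumFin (λ x → F₂ (g x) f) ≡ 0ℚ
    sum-F₂ β≢k = begin
      sumFin (λ x → F₂ (g x) f)
        ≡⟨ sumFin-cong {n} (λ x → cong₂ _*_ (cong (λ b → δ b k′) (block x))
                                         (joins (λ u w → (ν * inc u f - 1ℚ) * (ν * inc w f - 1ℚ))
                                                (λ u w → *-comm (ν * inc u f - 1ℚ) (ν * inc w f - 1ℚ)) x)) ⟩
      sumFin (λ x → δ β k′ * (c * (ν * inc (k , x) f - 1ℚ)))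
        ≡⟨ trans (sumFin-*ˡ (δ β k′) (λ x → c * (ν * inc (k , x) f - 1ℚ)))
                 (cong (δ β k′ *_) (sumFin-*ˡ c (λ x → ν * inc (k , x) f - 1ℚ))) ⟩
      δ β k′ * (c * sumFin (λ x → ν * inc (k , x) f - 1ℚ))
        ≡⟨ cong (λ s → δ β k′ * (c * s)) sum-row ⟩
      δ β k′ * (c * (ν * (1ℚ - δ k k′) - ν))
        ≡⟨ collapse (δ β k′) (δ k k′) c ν ⟩
      - (ν * c) * (δ β k′ * δ k k′)
        ≡⟨ cong (- (ν * c) *_) (δ-disjoint β≢k k′) ⟩
      - (ν * c) * 0ℚ
        ≡⟨ *-zeroʳ (- (ν * c)) ⟩
      0ℚ ∎
      where
      c = ν * inc v f - 1ℚ
      sum-row : sumFin (λ x → ν * inc (k , x) f - 1ℚ) ≡ ν * (1ℚ - δ k k′) - ν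
      sum-row = begin
        sumFin (λ x → ν * inc (k , x) f - 1ℚ)
          ≡⟨ sumFin-- (λ x → ν * inc (k , x) f) (λ _ → 1ℚ) ⟩
        sumFin (λ x → ν * inc (k , x) f) - sumFin {n} (λ _ → 1ℚ)
          ≡⟨ cong₂ _-_ (trans (sumFin-*ˡ ν (λ x → inc (k , x) f))
                              (cong (ν *_) (trans (sum-inc k f) (parts-partition k k′))))
                       (trans (sumFin-const {n} 1ℚ) (*-identityʳ ν)) ⟩
        ν * (1ℚ - δ k k′) - ν ∎
      collapse : ∀ b d c ν → b * (c * (ν * (1ℚ - d) - ν)) ≡ - (ν * c) * (b * d)
      collapse = solve-∀ ℚ-ring

  private
    highPart≢ : ∀ k → highPart k ≢ k
    highPart≢ zero ()
    highPart≢ (suc zero) ()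
    highPart≢ (suc (suc zero)) ()

    lowPart≢ : ∀ k → lowPart k ≢ k
    lowPart≢ zero ()
    lowPart≢ (suc zero) ()
    lowPart≢ (suc (suc zero)) ()

  open PencilSums

  A′₃-J : (A′₃ · J) ≈ ((ν + ν) ⊛ J)
  A′₃-J e f = begin
    (A′₃ · J) e f                                 ≡⟨ A′₃-·-fans J e f ⟩
    sumFin {n} (λ _ → 1ℚ) + sumFin {n} (λ _ → 1ℚ)  ≡⟨ cong₂ _+_ (sumFin-const {n} 1ℚ) (sumFin-const {n} 1ℚ) ⟩
    ν * 1ℚ + ν * 1ℚ                               ≡⟨ *-distribʳ-+ 1ℚ ν ν ⟨
    (ν + ν) * 1ℚ                                  ∎
    where open ≡-Reasoning

  A′₃-F₁ : (A′₃ · F₁) ≈ (ν ⊛ F₁)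
  A′₃-F₁ e f = begin
    (A′₃ · F₁) e f
      ≡⟨ A′₃-·-fans F₁ e f ⟩
    sumFin (λ x → F₁ (fan₁ e x) f) + sumFin (λ x → F₁ (fan₂ e x) f)
      ≡⟨ cong₂ _+_ (sum-F₁ (fan₁-pencil e) f) (sum-F₁ (fan₂-pencil e) f) ⟩
    (ν * (ν * i₁ + (1ℚ - d)) - (ν + ν * h)) + (ν * (ν * i₂ + (1ℚ - d)) - (ν + ν * l))
      ≡⟨ regroup ν i₁ i₂ d h l ⟩
    ν * F₁ e f + ν * ((1ℚ - d) - (l + h))
      ≡⟨ cong (λ s → ν * F₁ e f + ν * ((1ℚ - d) - s)) (blocks-partition k k′) ⟩
    ν * F₁ e f + ν * ((1ℚ - d) - (1ℚ - d))
      ≡⟨ vanish (ν * F₁ e f) ν (1ℚ - d) ⟩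
    ν * F₁ e f ∎
    where
    open ≡-Reasoning
    k = proj₁ e
    k′ = proj₁ f
    i₁ = inc (end₁ e) f
    i₂ = inc (end₂ e) f
    d = δ k k′
    h = δ (highPart k) k′
    l = δ (lowPart k) k′
    regroup : ∀ ν i₁ i₂ d h l →
      (ν * (ν * i₁ + (1ℚ - d)) - (ν + ν * h)) + (ν * (ν * i₂ + (1ℚ - d)) - (ν + ν * l))
        ≡ ν * (ν * (i₁ + i₂) - (1ℚ + d)) + ν * ((1ℚ - d) - (l + h))
    regroup = solve-∀ ℚ-ring
    vanish : ∀ x ν y → x + ν * (y - y) ≡ x
    vanish = solve-∀ ℚ-ring

  A′₃-F₂ : (A′₃ · F₂) ≈ (0ℚ ⊛ F₂)
  A′₃-F₂ e f = begin
    (A′₃ · F₂) e f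
      ≡⟨ A′₃-·-fans F₂ e f ⟩
    sumFin (λ x → F₂ (fan₁ e x) f) + sumFin (λ x → F₂ (fan₂ e x) f)
      ≡⟨ cong₂ _+_ (sum-F₂ (fan₁-pencil e) f (highPart≢ (proj₁ e))) (sum-F₂ (fan₂-pencil e) f (lowPart≢ (proj₁ e))) ⟩
    0ℚ + 0ℚ
      ≡⟨ *-zeroˡ (F₂ e f) ⟨
    0ℚ * F₂ e f ∎
    where open ≡-Reasoning


  classes : Edge n → Edge n → ℚ × ℚ × ℚ × ℚ × ℚ
  classes e f = A′₀ e f , A′₁ e f , A′₂ e f , A′₃ e f , A′₄ e f

  private
    ≟V-sym : (u v : Vertex n) → (u ≟V v) ≡ (v ≟V u)
    ≟V-sym = does-sym (≡-dec _≟F_ _≟F_)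

    ∨-middle : ∀ a b c d → a ∨ b ∨ c ∨ d ≡ a ∨ c ∨ b ∨ d
    ∨-middle a b c d = cong (a ∨_)
      (trans (sym (∨-assoc b c d)) (trans (cong (_∨ d) (∨-comm b c)) (∨-assoc c b d)))

  samePair-sym : (e f : Edge n) → samePair e f ≡ samePair f e
  samePair-sym e f = does-sym _≟F_ (proj₁ e) (proj₁ f)

  private
    sameIndices : Edge n → Edge n → Bool
    sameIndices (_ , a , b) (_ , a′ , b′) = does (a ≟F a′) ∧ does (b ≟F b′)

    sameIndices-sym : (e f : Edge n) → sameIndices e f ≡ sameIndices f e
    sameIndices-sym (_ , a , b) (_ , a′ , b′) = cong₂ _∧_ (does-sym _≟F_ a a′) (does-sym _≟F_ b b′)

  shareVertex-sym : (e f : Edge n) → shareVertex e f ≡ shareVertex f e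
  shareVertex-sym e f = trans
    (∨-middle (end₁ e ≟V end₁ f) (end₁ e ≟V end₂ f) (end₂ e ≟V end₁ f) (end₂ e ≟V end₂ f))
    (cong₂ _∨_ (≟V-sym (end₁ e) (end₁ f)) (cong₂ _∨_ (≟V-sym (end₂ e) (end₁ f))
      (cong₂ _∨_ (≟V-sym (end₁ e) (end₂ f)) (≟V-sym (end₂ e) (end₂ f)))))

  private
    classes-from : Bool × Bool × Bool → ℚ × ℚ × ℚ × ℚ × ℚ
    classes-from (sp , si , sv) =
      ind (sp ∧ si) , ind (sp ∧ not (sp ∧ si) ∧ sv) , ind (sp ∧ not sv) , ind (not sp ∧ sv) , ind (not sp ∧ not sv)

  classes-sym : (e f : Edge n) → classes e f ≡ classes f e
  classes-sym e f = cong classes-from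
    (cong₂ _,_ (samePair-sym e f) (cong₂ _,_ (sameIndices-sym e f) (shareVertex-sym e f)))

  -- Within a block the class of (e , f) is read off from P = [a = a′] and
  -- Q = [b = b′]; across blocks it is R₃ or R₄, and two edges of different
  -- blocks share at most one vertex.
  data Profile (e f : Edge n) : Set where
    inSameBlock : (P Q : ℚ) →
      classes e f ≡ (P * Q , P + Q - ℕ→ℚ 2 * (P * Q) , (1ℚ - P) * (1ℚ - Q) , 0ℚ , 0ℚ) →
      inc (end₁ e) f ≡ P → inc (end₂ e) f ≡ Q → sameBlock e f ≡ 1ℚ → Profile e f
    inDifferentBlocks : (S : ℚ) →
      classes e f ≡ (0ℚ , 0ℚ , 0ℚ , S , 1ℚ - S) → common e f ≡ S → sameBlock e f ≡ 0ℚ → Profile e f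

  private
    sameBlock-classes : ∀ p q → classes-from (true , p ∧ q , p ∨ q)
      ≡ (ind p * ind q , ind p + ind q - ℕ→ℚ 2 * (ind p * ind q) , (1ℚ - ind p) * (1ℚ - ind q) , 0ℚ , 0ℚ)
    sameBlock-classes true  true  = refl
    sameBlock-classes true  false = refl
    sameBlock-classes false true  = refl
    sameBlock-classes false false = refl

    differentBlocks-classes : ∀ sp si sv → sp ≡ false →
      classes-from (sp , si , sv) ≡ (0ℚ , 0ℚ , 0ℚ , ind sv , 1ℚ - ind sv)
    differentBlocks-classes .false si true  refl = refl
    differentBlocks-classes .false si false refl = refl

    sameBlockProfile : ∀ k (a b a′ b′ : Fin n) → Profile (k , a , b) (k , a′ , b′)
    sameBlockProfile zero a b a′ b′ = inSameBlock (δ a a′) (δ b b′)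
      (sameBlock-classes (does (a ≟F a′)) (does (b ≟F b′))) (+-identityʳ (δ a a′)) (+-identityˡ (δ b b′)) refl
    sameBlockProfile (suc zero) a b a′ b′ = inSameBlock (δ a a′) (δ b b′)
      (sameBlock-classes (does (a ≟F a′)) (does (b ≟F b′))) (+-identityʳ (δ a a′)) (+-identityˡ (δ b b′)) refl
    sameBlockProfile (suc (suc zero)) a b a′ b′ = inSameBlock (δ a a′) (δ b b′)
      (sameBlock-classes (does (a ≟F a′)) (does (b ≟F b′))) (+-identityʳ (δ a a′)) (+-identityˡ (δ b b′)) refl

    common-differentBlocks : (e f : Edge n) → samePair e f ≡ false → common e f ≡ ind (shareVertex e f)
    common-differentBlocks (zero , a , b) (zero , a′ , b′) ()
    common-differentBlocks (suc zero , a , b) (suc zero , a′ , b′) ()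
    common-differentBlocks (suc (suc zero) , a , b) (suc (suc zero) , a′ , b′) ()
    common-differentBlocks (zero , a , b) (suc zero , a′ , b′) _ with b ≟F b′
    ... | yes _ = refl
    ... | no _  = refl
    common-differentBlocks (zero , a , b) (suc (suc zero) , a′ , b′) _ with a ≟F b′
    ... | yes _ = refl
    ... | no _  = refl
    common-differentBlocks (suc zero , a , b) (zero , a′ , b′) _ with b ≟F b′
    ... | yes _ = refl
    ... | no _  = refl
    common-differentBlocks (suc zero , a , b) (suc (suc zero) , a′ , b′) _ with a ≟F a′
    ... | yes _ = refl
    ... | no _  = refl
    common-differentBlocks (suc (suc zero) , a , b) (zero , a′ , b′) _ with b ≟F a′
    ... | yes _ = refl
    ... | no _  = refl
    common-differentBlocks (suc (suc zero) , a , b) (suc zero , a′ , b′) _ with a ≟F a′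
    ... | yes _ = refl
    ... | no _  = refl

  profile : (e f : Edge n) → Profile e f
  profile (k , a , b) (k′ , a′ , b′) with k ≟F k′
  ... | yes refl = sameBlockProfile k a b a′ b′
  ... | no k≢k′ = inDifferentBlocks (ind (shareVertex e f))
                    (differentBlocks-classes (samePair e f) (sameIndices e f) (shareVertex e f) sp≡false)
                    (common-differentBlocks e f sp≡false) (cong ind sp≡false)
    where
    e f : Edge n
    e = k , a , b
    f = k′ , a′ , b′
    sp≡false : samePair e f ≡ false
    sp≡false = dec-false (k ≟F k′) k≢k′

  private
    Classes : Set
    Classes = ℚ × ℚ × ℚ × ℚ × ℚ

    total F₁-combination F₂-combination M-combination : Classes → ℚ
    total (a₀ , a₁ , a₂ , a₃ , a₄) = a₀ + a₁ + a₂ + a₃ + a₄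
    F₁-combination (a₀ , a₁ , a₂ , a₃ , a₄) =
      ℕ→ℚ 2 * (ν - 1ℚ) * a₀ + (ν - ℕ→ℚ 2) * a₁ - ℕ→ℚ 2 * a₂ + (ν - 1ℚ) * a₃ - a₄
    F₂-combination (a₀ , a₁ , a₂ , a₃ , a₄) = (ν - 1ℚ) * (ν - 1ℚ) * a₀ - (ν - 1ℚ) * a₁ + a₂
    M-combination (a₀ , a₁ , a₂ , a₃ , a₄) = ν * (ν * a₀ + a₃)

  class-total : (e f : Edge n) → A′₀ e f + A′₁ e f + A′₂ e f + A′₃ e f + A′₄ e f ≡ 1ℚ
  class-total e f with profile e f
  ... | inSameBlock P Q cls _ _ _ = trans (cong total cls) (poly P Q)
    where
    poly : ∀ P Q → P * Q + (P + Q - ℕ→ℚ 2 * (P * Q)) + (1ℚ - P) * (1ℚ - Q) + 0ℚ + 0ℚ ≡ 1ℚ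
    poly = solve-∀ ℚ-ring
  ... | inDifferentBlocks S cls _ _ = trans (cong total cls) (poly S)
    where
    poly : ∀ S → 0ℚ + 0ℚ + 0ℚ + S + (1ℚ - S) ≡ 1ℚ
    poly = solve-∀ ℚ-ring

  F₁-classes : (e f : Edge n) →
    F₁ e f ≡ ℕ→ℚ 2 * (ν - 1ℚ) * A′₀ e f + (ν - ℕ→ℚ 2) * A′₁ e f - ℕ→ℚ 2 * A′₂ e f
             + (ν - 1ℚ) * A′₃ e f - A′₄ e f
  F₁-classes e f with profile e f
  ... | inSameBlock P Q cls i₁ i₂ sb =
    trans (cong₂ (λ c s → ν * c - (1ℚ + s)) (cong₂ _+_ i₁ i₂) sb)
          (trans (poly ν P Q) (sym (cong F₁-combination cls)))
    where
    poly : ∀ ν P Q → ν * (P + Q) - (1ℚ + 1ℚ) ≡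
      ℕ→ℚ 2 * (ν - 1ℚ) * (P * Q) + (ν - ℕ→ℚ 2) * (P + Q - ℕ→ℚ 2 * (P * Q))
        - ℕ→ℚ 2 * ((1ℚ - P) * (1ℚ - Q)) + (ν - 1ℚ) * 0ℚ - 0ℚ
    poly = solve-∀ ℚ-ring
  ... | inDifferentBlocks S cls c sb =
    trans (cong₂ (λ c s → ν * c - (1ℚ + s)) c sb) (trans (poly ν S) (sym (cong F₁-combination cls)))
    where
    poly : ∀ ν S → ν * S - (1ℚ + 0ℚ) ≡
      ℕ→ℚ 2 * (ν - 1ℚ) * 0ℚ + (ν - ℕ→ℚ 2) * 0ℚ - ℕ→ℚ 2 * 0ℚ + (ν - 1ℚ) * S - (1ℚ - S)
    poly = solve-∀ ℚ-ring

  F₂-classes : (e f : Edge n) → F₂ e f ≡ (ν - 1ℚ) * (ν - 1ℚ) * A′₀ e f - (ν - 1ℚ) * A′₁ e f + A′₂ e f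
  F₂-classes e f with profile e f
  ... | inSameBlock P Q cls i₁ i₂ sb =
    trans (cong₂ (λ s p → s * p) sb (cong₂ (λ x y → (ν * x - 1ℚ) * (ν * y - 1ℚ)) i₁ i₂))
          (trans (poly ν P Q) (sym (cong F₂-combination cls)))
    where
    poly : ∀ ν P Q → 1ℚ * ((ν * P - 1ℚ) * (ν * Q - 1ℚ)) ≡
      (ν - 1ℚ) * (ν - 1ℚ) * (P * Q) - (ν - 1ℚ) * (P + Q - ℕ→ℚ 2 * (P * Q)) + (1ℚ - P) * (1ℚ - Q)
    poly = solve-∀ ℚ-ring
  ... | inDifferentBlocks S cls c sb =
    trans (cong (_* ((ν * inc (end₁ e) f - 1ℚ) * (ν * inc (end₂ e) f - 1ℚ))) sb)
          (trans (poly ν ((ν * inc (end₁ e) f - 1ℚ) * (ν * inc (end₂ e) f - 1ℚ))) (sym (cong F₂-combination cls)))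
    where
    poly : ∀ ν x → 0ℚ * x ≡ (ν - 1ℚ) * (ν - 1ℚ) * 0ℚ - (ν - 1ℚ) * 0ℚ + 0ℚ
    poly = solve-∀ ℚ-ring

  J+F₁+F₂ : (e f : Edge n) → 1ℚ + F₁ e f + F₂ e f ≡ ν * (ν * A′₀ e f + A′₃ e f)
  J+F₁+F₂ e f with profile e f
  ... | inSameBlock P Q cls i₁ i₂ sb = begin
    1ℚ + (ν * (i₁′ + i₂′) - (1ℚ + sb′)) + sb′ * ((ν * i₁′ - 1ℚ) * (ν * i₂′ - 1ℚ))
      ≡⟨ cong₂ (λ (x , y) s → 1ℚ + (ν * (x + y) - (1ℚ + s)) + s * ((ν * x - 1ℚ) * (ν * y - 1ℚ)))
               (cong₂ _,_ i₁ i₂) sb ⟩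
    1ℚ + (ν * (P + Q) - (1ℚ + 1ℚ)) + 1ℚ * ((ν * P - 1ℚ) * (ν * Q - 1ℚ))
      ≡⟨ poly ν P Q ⟩
    ν * (ν * (P * Q) + 0ℚ)
      ≡⟨ cong M-combination cls ⟨
    ν * (ν * A′₀ e f + A′₃ e f) ∎
    where
    open ≡-Reasoning
    i₁′ = inc (end₁ e) f
    i₂′ = inc (end₂ e) f
    sb′ = sameBlock e f
    poly : ∀ ν P Q → 1ℚ + (ν * (P + Q) - (1ℚ + 1ℚ)) + 1ℚ * ((ν * P - 1ℚ) * (ν * Q - 1ℚ)) ≡ ν * (ν * (P * Q) + 0ℚ)
    poly = solve-∀ ℚ-ring
  ... | inDifferentBlocks S cls c sb = begin
    1ℚ + (ν * common e f - (1ℚ + sameBlock e f)) + sameBlock e f * rest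
      ≡⟨ cong₂ (λ c s → 1ℚ + (ν * c - (1ℚ + s)) + s * rest) c sb ⟩
    1ℚ + (ν * S - (1ℚ + 0ℚ)) + 0ℚ * rest
      ≡⟨ poly ν S rest ⟩
    ν * (ν * 0ℚ + S)
      ≡⟨ cong M-combination cls ⟨
    ν * (ν * A′₀ e f + A′₃ e f) ∎
    where
    open ≡-Reasoning
    rest = (ν * inc (end₁ e) f - 1ℚ) * (ν * inc (end₂ e) f - 1ℚ)
    poly : ∀ ν S r → 1ℚ + (ν * S - (1ℚ + 0ℚ)) + 0ℚ * r ≡ ν * (ν * 0ℚ + S)
    poly = solve-∀ ℚ-ring

  F₁-sym : IsSymmetric F₁
  F₁-sym e f = trans (F₁-classes e f) (trans (cong F₁-combination (classes-sym e f)) (sym (F₁-classes f e)))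

  F₂-sym : IsSymmetric F₂
  F₂-sym e f = trans (F₂-classes e f) (trans (cong F₂-combination (classes-sym e f)) (sym (F₂-classes f e)))


  apex : Edge n → Fin n → Triangle n
  apex (zero , a , b) x           = x , a , b
  apex (suc zero , a , b) x       = a , x , b
  apex (suc (suc zero) , a , b) x = a , b , x

  private
    sum-δδ : (c c′ : Fin n) (G : Fin n → Fin n → ℚ) →
      sumFin (λ y → sumFin (λ z → ind (does (c ≟F y) ∧ does (c′ ≟F z)) * G y z)) ≡ G c c′
    sum-δδ c c′ G = begin
      sumFin (λ y → sumFin (λ z → ind (does (c ≟F y) ∧ does (c′ ≟F z)) * G y z))
        ≡⟨ sumFin-cong (λ y → sumFin-cong (λ z →
             trans (cong (_* G y z) (ind-∧ (does (c ≟F y)) (does (c′ ≟F z)))) (*-assoc (δ c y) (δ c′ z) (G y z)))) ⟩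
      sumFin (λ y → sumFin (λ z → δ c y * (δ c′ z * G y z)))
        ≡⟨ sumFin-cong (λ y → trans (sumFin-*ˡ (δ c y) (λ z → δ c′ z * G y z)) (cong (δ c y *_) (sumFin-δ c′ (G y)))) ⟩
      sumFin (λ y → δ c y * G y c′)
        ≡⟨ sumFin-δ c (λ y → G y c′) ⟩
      G c c′ ∎
      where open ≡-Reasoning

  M-apex : (e f : Edge n) → M e f ≡ sumFin (λ x → W f (apex e x))
  M-apex (zero , a , b) f = sumFin-cong λ x → sum-δδ a b (λ y z → W f (x , y , z))
  M-apex (suc zero , a , b) f =
    trans (sumFin-swap (λ x y → sumFin λ z → W (suc zero , a , b) (x , y , z) * W f (x , y , z)))
          (sumFin-cong λ y → sum-δδ a b (λ x z → W f (x , y , z)))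
  M-apex (suc (suc zero) , a , b) f =
    trans (sumFin-cong λ x → sumFin-cong λ y →
             sumFin-*ˡ (ind (does (a ≟F x) ∧ does (b ≟F y))) (λ z → W f (x , y , z)))
          (sum-δδ a b (λ x y → sumFin (λ z → W f (x , y , z))))

  private
    sum-const-pair : (a b a′ b′ : Fin n) →
      sumFin {n} (λ _ → ind (does (a′ ≟F a) ∧ does (b′ ≟F b))) ≡ ν * ind (does (a ≟F a′) ∧ does (b ≟F b′)) + 0ℚ
    sum-const-pair a b a′ b′ = trans (sumFin-const {n} (ind (does (a′ ≟F a) ∧ does (b′ ≟F b))))
      (trans (cong₂ (λ p q → ν * ind (p ∧ q)) (does-sym _≟F_ a′ a) (does-sym _≟F_ b′ b))
             (sym (+-identityʳ (ν * ind (does (a ≟F a′) ∧ does (b ≟F b′))))))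

    sum-δ-∧ˡ : (c : Fin n) (d : Bool) → sumFin (λ x → ind (does (c ≟F x) ∧ d)) ≡ ind d
    sum-δ-∧ˡ c d = trans (sumFin-cong λ x → ind-∧ (does (c ≟F x)) d) (sumFin-δ c (λ _ → ind d))

    sum-δ-∧ʳ : (c : Fin n) (d : Bool) → sumFin (λ x → ind (d ∧ does (c ≟F x))) ≡ ind d
    sum-δ-∧ʳ c d = trans (sumFin-cong λ x → trans (ind-∧ d (does (c ≟F x))) (*-comm (ind d) (δ c x)))
                         (sumFin-δ c (λ _ → ind d))

    cross-entry : ∀ s (x y : Fin n) → ind s ≡ δ x y → δ y x ≡ ν * 0ℚ + ind s
    cross-entry s x y s≡δ = trans (δ-sym y x) (trans (sym s≡δ)
      (sym (trans (cong (_+ ind s) (*-zeroʳ ν)) (+-identityˡ (ind s)))))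

  M≈νI+A′₃ : M ≈ ((ν ⊛ I) ⊕ A′₃)
  M≈νI+A′₃ e@(zero , a , b) f@(zero , a′ , b′) = trans (M-apex e f) (sum-const-pair a b a′ b′)
  M≈νI+A′₃ e@(zero , a , b) f@(suc zero , a′ , b′) =
    trans (M-apex e f) (trans (sum-δ-∧ˡ a′ (does (b′ ≟F b))) (cross-entry (does (b ≟F b′)) b b′ refl))
  M≈νI+A′₃ e@(zero , a , b) f@(suc (suc zero) , a′ , b′) =
    trans (M-apex e f) (trans (sum-δ-∧ˡ a′ (does (b′ ≟F a))) (cross-entry (does (a ≟F b′) ∨ false) a b′ (δ-∨false a b′)))
  M≈νI+A′₃ e@(suc zero , a , b) f@(zero , a′ , b′) =
    trans (M-apex e f) (trans (sum-δ-∧ˡ a′ (does (b′ ≟F b))) (cross-entry (does (b ≟F b′)) b b′ refl))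
  M≈νI+A′₃ e@(suc zero , a , b) f@(suc zero , a′ , b′) = trans (M-apex e f) (sum-const-pair a b a′ b′)
  M≈νI+A′₃ e@(suc zero , a , b) f@(suc (suc zero) , a′ , b′) =
    trans (M-apex e f) (trans (sum-δ-∧ʳ b′ (does (a′ ≟F a))) (cross-entry (does (a ≟F a′) ∨ false) a a′ (δ-∨false a a′)))
  M≈νI+A′₃ e@(suc (suc zero) , a , b) f@(zero , a′ , b′) =
    trans (M-apex e f) (trans (sum-δ-∧ʳ b′ (does (a′ ≟F b))) (cross-entry (does (b ≟F a′) ∨ false) b a′ (δ-∨false b a′)))
  M≈νI+A′₃ e@(suc (suc zero) , a , b) f@(suc zero , a′ , b′) =
    trans (M-apex e f) (trans (sum-δ-∧ʳ b′ (does (a′ ≟F a))) (cross-entry (does (a ≟F a′) ∨ false) a a′ (δ-∨false a a′)))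
  M≈νI+A′₃ e@(suc (suc zero) , a , b) f@(suc (suc zero) , a′ , b′) = trans (M-apex e f) (sum-const-pair a b a′ b′)

  M-symmetric : IsSymmetric (M {n})
  M-symmetric e f = sumFin-cong λ x → sumFin-cong λ y → sumFin-cong λ z → *-comm (W e (x , y , z)) (W f (x , y , z))

  M-eigen : {E F : Mat n} {c μ : ℚ} → E ≈ (c ⊛ F) → (A′₃ · F) ≈ (μ ⊛ F) → (M · E) ≈ ((ν + μ) ⊛ E)
  M-eigen {E} {F} {c} {μ} E≈cF A′₃F≈μF e f = begin
    sumE (λ g → M e g * E g f)
      ≡⟨ sumE-cong (λ g → trans (cong (_* E g f) (M≈νI+A′₃ e g))
                                (distrib ν (I e g) (A′₃ e g) (E g f) c (F g f) (E≈cF g f))) ⟩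
    sumE (λ g → ν * (I e g * E g f) + c * (A′₃ e g * F g f))
      ≡⟨ sumE-linear ν c (λ g → I e g * E g f) (λ g → A′₃ e g * F g f) ⟩
    ν * sumE (λ g → I e g * E g f) + c * (A′₃ · F) e f
      ≡⟨ cong₂ (λ x y → ν * x + c * y) (sumE-I e (λ g → E g f)) (A′₃F≈μF e f) ⟩
    ν * E e f + c * (μ * F e f)
      ≡⟨ cong (λ x → ν * E e f + x) (rearrange c μ (F e f)) ⟩
    ν * E e f + μ * (c * F e f)
      ≡⟨ cong (λ x → ν * E e f + μ * x) (sym (E≈cF e f)) ⟩
    ν * E e f + μ * E e f
      ≡⟨ *-distribʳ-+ (E e f) ν μ ⟨
    (ν + μ) * E e f ∎
    where
    open ≡-Reasoning
    distrib : ∀ ν i a x c y → x ≡ c * y → (ν * i + a) * x ≡ ν * (i * x) + c * (a * y)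
    distrib ν i a .(c * y) c y refl = solve′ ν i a c y
      where
      solve′ : ∀ ν i a c y → (ν * i + a) * (c * y) ≡ ν * (i * (c * y)) + c * (a * y)
      solve′ = solve-∀ ℚ-ring
    rearrange : ∀ c μ x → c * (μ * x) ≡ μ * (c * x)
    rearrange = solve-∀ ℚ-ring

  scaled-sym : {E F : Mat n} {c : ℚ} → E ≈ (c ⊛ F) → IsSymmetric F → IsSymmetric E
  scaled-sym {c = c} E≈cF F-sym e f = trans (E≈cF e f) (trans (cong (c *_) (F-sym e f)) (sym (E≈cF f e)))


module Eigenprojections (m : ℕ) where

  private
    n : ℕ
    n = suc m

    ν w w₂ w₃ : ℚ
    ν = ℕ→ℚ n
    w = frac (+ 1) (n ℕ.* n)
    w₂ = frac (+ 1) (2 ℕ.* (n ℕ.* n))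
    w₃ = frac (+ 1) (3 ℕ.* (n ℕ.* n))

    w-inverse : w * (ν * ν) ≡ 1ℚ
    w-inverse = trans (cong (w *_) (sym (ℕ→ℚ-* n n))) (frac-inverse (m ℕ.+ m ℕ.* n))

    2w₂≡w : ℕ→ℚ 2 * w₂ ≡ w
    2w₂≡w = frac-cancelˡ 1 (m ℕ.+ m ℕ.* n)

    3w₃≡w : ℕ→ℚ 3 * w₃ ≡ w
    3w₃≡w = frac-cancelˡ 2 (m ℕ.+ m ℕ.* n)

  E₀≈ : E₀ n ≈ (w₃ ⊛ J)
  E₀≈ e f = cong (w₃ *_) (class-total e f)

  E₁≈ : E₁ n ≈ (w₂ ⊛ F₁)
  E₁≈ e f = begin
    (ν - 1ℚ) * w * a₀ + (ν - ℕ→ℚ 2) * w₂ * a₁ - w * a₂ + (ν - 1ℚ) * w₂ * a₃ - w₂ * a₄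
      ≡⟨ cong (λ x → (ν - 1ℚ) * x * a₀ + (ν - ℕ→ℚ 2) * w₂ * a₁ - x * a₂ + (ν - 1ℚ) * w₂ * a₃ - w₂ * a₄)
              (sym 2w₂≡w) ⟩
    (ν - 1ℚ) * (ℕ→ℚ 2 * w₂) * a₀ + (ν - ℕ→ℚ 2) * w₂ * a₁ - ℕ→ℚ 2 * w₂ * a₂
      + (ν - 1ℚ) * w₂ * a₃ - w₂ * a₄
      ≡⟨ factor ν w₂ a₀ a₁ a₂ a₃ a₄ ⟩
    w₂ * (ℕ→ℚ 2 * (ν - 1ℚ) * a₀ + (ν - ℕ→ℚ 2) * a₁ - ℕ→ℚ 2 * a₂ + (ν - 1ℚ) * a₃ - a₄)
      ≡⟨ cong (w₂ *_) (F₁-classes e f) ⟨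
    w₂ * F₁ e f ∎
    where
    open ≡-Reasoning
    a₀ = A′₀ e f
    a₁ = A′₁ e f
    a₂ = A′₂ e f
    a₃ = A′₃ e f
    a₄ = A′₄ e f
    factor : ∀ ν w₂ a₀ a₁ a₂ a₃ a₄ →
      (ν - 1ℚ) * (ℕ→ℚ 2 * w₂) * a₀ + (ν - ℕ→ℚ 2) * w₂ * a₁ - ℕ→ℚ 2 * w₂ * a₂
        + (ν - 1ℚ) * w₂ * a₃ - w₂ * a₄
        ≡ w₂ * (ℕ→ℚ 2 * (ν - 1ℚ) * a₀ + (ν - ℕ→ℚ 2) * a₁ - ℕ→ℚ 2 * a₂ + (ν - 1ℚ) * a₃ - a₄)
    factor = solve-∀ ℚ-ring

  E₂≈ : E₂ n ≈ (w ⊛ F₂)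
  E₂≈ e f = trans (factor ν w (A′₀ e f) (A′₁ e f) (A′₂ e f)) (cong (w *_) (sym (F₂-classes e f)))
    where
    factor : ∀ ν w a₀ a₁ a₂ →
      (ν - 1ℚ) * (ν - 1ℚ) * w * a₀ - (ν - 1ℚ) * w * a₁ + w * a₂
        ≡ w * ((ν - 1ℚ) * (ν - 1ℚ) * a₀ - (ν - 1ℚ) * a₁ + a₂)
    factor = solve-∀ ℚ-ring

  private
    λ₀ λ₁ : ℚ
    λ₀ = ℕ→ℚ (3 ℕ.* n)
    λ₁ = ℕ→ℚ (2 ℕ.* n)

    λ₀≡ : ν + (ν + ν) ≡ λ₀
    λ₀≡ = trans (triple ν) (sym (ℕ→ℚ-* 3 n))
      where
      triple : ∀ ν → ν + (ν + ν) ≡ ℕ→ℚ 3 * ν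
      triple = solve-∀ ℚ-ring

    λ₁≡ : ν + ν ≡ λ₁
    λ₁≡ = trans (double ν) (sym (ℕ→ℚ-* 2 n))
      where
      double : ∀ ν → ν + ν ≡ ℕ→ℚ 2 * ν
      double = solve-∀ ℚ-ring

    M-resolution : ∀ e f → M e f ≡ λ₀ * E₀ n e f + λ₁ * E₁ n e f + ν * E₂ n e f
    M-resolution e f = sym (begin
      λ₀ * E₀ n e f + λ₁ * E₁ n e f + ν * E₂ n e f
        ≡⟨ cong₂ _+_ (cong₂ _+_ (cong₂ _*_ (ℕ→ℚ-* 3 n) (E₀≈ e f)) (cong₂ _*_ (ℕ→ℚ-* 2 n) (E₁≈ e f)))
                     (cong (ν *_) (E₂≈ e f)) ⟩
      ℕ→ℚ 3 * ν * (w₃ * 1ℚ) + ℕ→ℚ 2 * ν * (w₂ * F₁ e f) + ν * (w * F₂ e f)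
        ≡⟨ regroup ν w₃ w₂ w (F₁ e f) (F₂ e f) ⟩
      ν * (ℕ→ℚ 3 * w₃) + ν * (ℕ→ℚ 2 * w₂) * F₁ e f + ν * w * F₂ e f
        ≡⟨ cong₂ (λ x y → ν * x + ν * y * F₁ e f + ν * w * F₂ e f) 3w₃≡w 2w₂≡w ⟩
      ν * w + ν * w * F₁ e f + ν * w * F₂ e f
        ≡⟨ factor (ν * w) (F₁ e f) (F₂ e f) ⟩
      ν * w * (1ℚ + F₁ e f + F₂ e f)
        ≡⟨ cong (ν * w *_) (J+F₁+F₂ e f) ⟩
      ν * w * (ν * (ν * A′₀ e f + A′₃ e f))
        ≡⟨ rescale ν w (ν * A′₀ e f + A′₃ e f) ⟩
      w * (ν * ν) * (ν * A′₀ e f + A′₃ e f)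
        ≡⟨ trans (cong (_* (ν * A′₀ e f + A′₃ e f)) w-inverse) (*-identityˡ _) ⟩
      ν * A′₀ e f + A′₃ e f
        ≡⟨ M≈νI+A′₃ e f ⟨
      M e f ∎)
      where
      open ≡-Reasoning
      regroup : ∀ ν w₃ w₂ w x y → ℕ→ℚ 3 * ν * (w₃ * 1ℚ) + ℕ→ℚ 2 * ν * (w₂ * x) + ν * (w * y)
                                    ≡ ν * (ℕ→ℚ 3 * w₃) + ν * (ℕ→ℚ 2 * w₂) * x + ν * w * y
      regroup = solve-∀ ℚ-ring
      factor : ∀ c x y → c + c * x + c * y ≡ c * (1ℚ + x + y)
      factor = solve-∀ ℚ-ring
      rescale : ∀ ν w z → ν * w * (ν * z) ≡ w * (ν * ν) * z
      rescale = solve-∀ ℚ-ring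

    *n-injective : ∀ {a b} → a ≢ b → a ℕ.* n ≢ b ℕ.* n
    *n-injective a≢b = a≢b ∘ ℕ.*-cancelʳ-≡ _ _ n

    *n≢n : ∀ {a} → a ≢ 1 → a ℕ.* n ≢ n
    *n≢n a≢1 eq = *n-injective a≢1 (trans eq (sym (ℕ.*-identityˡ n)))

  open SpectralResolution {M = M} {E₀ n} {E₁ n} {E₂ n} {λ₀} {λ₁} {ν}
    M-symmetric
    (scaled-sym {F = J} {w₃} E₀≈ (λ _ _ → refl))
    (scaled-sym {F = F₁} {w₂} E₁≈ F₁-sym)
    (scaled-sym {F = F₂} {w} E₂≈ F₂-sym)
    (λ e f → trans (M-eigen {F = J} {c = w₃} E₀≈ A′₃-J e f) (cong (_* E₀ n e f) λ₀≡))
    (λ e f → trans (M-eigen {F = F₁} {c = w₂} E₁≈ A′₃-F₁ e f) (cong (_* E₁ n e f) λ₁≡))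
    (λ e f → trans (M-eigen {F = F₂} {c = w} E₂≈ A′₃-F₂ e f) (cong (_* E₂ n e f) (+-identityʳ ν)))
    M-resolution
    (ℕ→ℚ-≢ (*n-injective {3} {2} λ ())) (ℕ→ℚ-≢ (*n≢n {3} λ ())) (ℕ→ℚ-≢ (*n≢n {2} λ ()))
    (ℕ→ℚ-≢ {3 ℕ.* n} {0} λ ()) (ℕ→ℚ-≢ {2 ℕ.* n} {0} λ ()) (ℕ→ℚ-≢ {n} {0} λ ())
    public

proposition4p6 : (n : ℕ) → 2 ≤ n →
    IsOrthProjOnto (E₀ n) (Eigenspace M (ℕ→ℚ (3 ℕ.* n))) ×
    IsOrthProjOnto (E₁ n) (Eigenspace M (ℕ→ℚ (2 ℕ.* n))) ×
    IsOrthProjOnto (E₂ n) (Eigenspace M (ℕ→ℚ n)) ×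
    IsOrthProjOnto (K n) (Kernel M)
-- the hypothesis 2 ≤ n serves only to rule out n = 0
proposition4p6 (suc m) _ = P₀-projection , P₁-projection , P₂-projection , Q-projection
  where open Eigenprojections m
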